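{- Let $g\geq 2$. For $m\geq1$ define $$P_m(a_1,\dots,a_m)=\sum_{k=1}^m\frac{(-1)^k(2g-3+k)!}{k!}\sum_{\substack{I_1\sqcup\cdots\sqcup I_k=\{1,\dots,m\}\\ I_j\neq\varnothing\ \forall j}}\ \sum_{\substack{d_1,\dots,d_k\in\mathbb{Z}_{\geq0}\\ d_1+\cdots+d_k=g-2+m}}\prod_{j=1}^k\binom{2a_{[I_j]}+1}{2d_j}\prod_{i=1}^{|I_j|-1}(2d_j+1-2i).$$ Then for every $n\geq1$ and all $a_1,\dots,a_n\in\mathbb{Z}_{\geq0}$ with $a_1+\cdots+a_n=2g-3+n$, $$P_{n+1}(a_1,\dots,a_n,1)=(2n-2)\,P_n(a_1,\dots,a_n).$$ In particular $P_2(2g-2,1)=0$, and for $n\geq 2$ the vanishing of $P_n(a_1,\dots,a_n)$ implies the vanishing of $P_{n+1}(a_1,\dots,a_n,1)$.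
   Context: Here $\binom{x}{m}=\frac{x(x-1)\cdots(x-m+1)}{m!}$; $a_{[I]}=\sum_{\ell\in I}a_\ell$; the sum over $I_1\sqcup\cdots\sqcup I_k$ runs over ordered $k$-tuples of nonempty disjoint subsets with union $\{1,\dots,m\}$. -}

module Defs where

open import Data.Nat as ℕ using (ℕ; zero; suc; _∸_; _!; _≤ᵇ_)
open import Data.Nat.Properties using (_!≢0)
open import Data.Nat.Combinatorics using (_C_)
open import Data.Integer as ℤ using (ℤ; +_; -_)
open import Data.Rational as ℚ using (ℚ)
open import Data.Fin using (Fin; _≟_)
open import Data.Vec as Vec using (Vec; []; _∷_)
open import Data.List as List using (List; []; _∷_; [_]; concatMap; map; upTo; allFin; filterᵇ; foldr)
open import Data.Bool using (Bool; true; false; if_then_else_; _∧_)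
open import Relation.Nullary.Decidable using (⌊_⌋)

allMaps : (k m : ℕ) → List (Vec (Fin k) m)
allMaps k zero    = [ [] ]
allMaps k (suc m) = concatMap (λ i → map (i ∷_) (allMaps k m)) (allFin k)

blockSize : ∀ {k m} → Vec (Fin k) m → Fin k → ℕ
blockSize []      j = 0
blockSize (i ∷ f) j = (if ⌊ i ≟ j ⌋ then 1 else 0) ℕ.+ blockSize f j

blockSum : ∀ {k m} → Vec (Fin k) m → Vec ℕ m → Fin k → ℕ
blockSum []      []      j = 0
blockSum (i ∷ f) (x ∷ a) j = (if ⌊ i ≟ j ⌋ then x else 0) ℕ.+ blockSum f a j

allBlocksNonempty : ∀ {k m} → Vec (Fin k) m → Bool
allBlocksNonempty {k} f = foldr (λ j b → (1 ≤ᵇ blockSize f j) ∧ b) true (allFin k)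

-- Ordered k-tuples (I_1,…,I_k) of nonempty disjoint subsets with union {1..m},
-- encoded by the map ℓ ↦ (the j with ℓ ∈ I_j).
orderedPartitions : (k m : ℕ) → List (Vec (Fin k) m)
orderedPartitions k m = filterᵇ allBlocksNonempty (allMaps k m)

compositions : (k n : ℕ) → List (Vec ℕ k)
compositions zero    zero    = [ [] ]
compositions zero    (suc n) = []
compositions (suc k) n = concatMap (λ d → map (d ∷_) (compositions k (n ∸ d))) (upTo (suc n))

sumℤ : List ℤ → ℤ
sumℤ = foldr ℤ._+_ (+ 0)

sumℚ : List ℚ → ℚ
sumℚ = foldr ℚ._+_ ℚ.0ℚ

prodℤ : List ℤ → ℤ
prodℤ = foldr ℤ._*_ (+ 1)

oddProd : ℕ → ℕ → ℤ
oddProd d s = prodℤ (map (λ i → (+ (2 ℕ.* d ℕ.+ 1)) ℤ.- (+ (2 ℕ.* i))) (List.drop 1 (upTo s)))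

term : ∀ {k m} → Vec ℕ m → Vec (Fin k) m → Vec ℕ k → ℤ
term {k} a f ds = prodℤ (map (λ j → let d = Vec.lookup ds j in
    (+ ((2 ℕ.* blockSum f a j ℕ.+ 1) C (2 ℕ.* d))) ℤ.* oddProd d (blockSize f j)) (allFin k))

innerSum : (g k m : ℕ) → Vec ℕ m → ℤ
innerSum g k m a = sumℤ (concatMap (λ f → map (term a f) (compositions k (g ∸ 2 ℕ.+ m)))
                                   (orderedPartitions k m))

signℤ : ℕ → ℤ
signℤ zero    = + 1
signℤ (suc k) = - signℤ k

coeff : ℕ → ℕ → ℚ
coeff g k = (signℤ k ℤ.* (+ ((2 ℕ.* g ∸ 3 ℕ.+ k) !))) ℚ./ (k !)
  where instance _ = k !≢0

P : (g m : ℕ) → Vec ℕ m → ℚ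
P g m a = sumℚ (map (λ k → coeff g k ℚ.* ((innerSum g k m a) ℚ./ 1)) (List.drop 1 (upTo (suc m))))

-- The sum over d_1 + ⋯ + d_k = g − 2 + m is then the coefficient of x^{g−2+m} in the
-- product of the block series w_{A,s}(x) = Σ_d C(2A + 1, 2d) ∏_{i=1}^{s−1} (2d + 1 − 2i) x^d,
-- one for each block, with A = a_[I_j] and s = |I_j|.
--
-- Appending a part a_{n+1} = 1 either creates the singleton block {n + 1}, whose series is 1 + 3x,
-- or enlarges a block; Pascal's rule and absorption give w_{A+1,s+1} = 𝒟_{1−2s,4A+3} w_{A,s} for
-- the operator (𝒟_{c,b} h)_e = (c + 2e) h_e + (b − 2(e − 1)) h_{e−1}. Since multiplication by e is a
-- derivation, 𝒟_{c,b} f · g + f · 𝒟_{c′,b′} g = 𝒟_{c+c′,b+b′} (f · g), so summing over the enlarged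
-- block applies 𝒟_{k−2n, 4a_[n]+3k} to the whole product: its parameters depend only on k. Weighted
-- by (−1)^k (2g − 3 + k)!/k!, the singleton terms with k + 1 blocks cancel the top coefficient of
-- the 𝒟-terms with k blocks, and when a_[n] = 2g − 3 + n what survives is 2n − 2 times the
-- coefficient of x^{g−2+n}, that is (2n − 2) P_n.

module Submission where

open import Defs
open import Data.Nat using (ℕ; suc; _+_; _*_; _∸_; _≤_)
open import Data.Integer using (+_)
open import Data.Rational using (ℚ; 0ℚ; _/_) renaming (_*_ to _*ℚ_)
open import Data.Vec using (Vec; _∷_; []; _∷ʳ_; sum)
open import Data.Product using (_×_)
open import Relation.Binary.PropositionalEquality using (_≡_)

import Algebra.Properties.CommutativeMonoid.Sum as CommutativeMonoidSum
import Algebra.Properties.Semiring.Sum as SemiringSum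
open import Data.Bool using (Bool; true; false; if_then_else_; _∧_)
import Data.Bool.Properties as Bool
open import Data.Empty using (⊥-elim)
open import Data.Fin as Fin using (Fin; punchIn)
import Data.Fin.Properties as Fin
open import Data.Integer as ℤ using (ℤ; -_)
  renaming (_+_ to _+ℤ_; _*_ to _*ℤ_; _-_ to _-ℤ_)
import Data.Integer.Properties as ℤ
open import Data.Integer.Tactic.RingSolver using (solve-∀)
open import Data.List as List using (List; []; _∷_; [_]; _++_; map; concatMap; applyUpTo; tabulate; foldr; allFin)
import Data.List.Properties as List
open import Data.Nat as ℕ using (zero; z≤n; s≤s; _≤ᵇ_; _!)
open import Data.Nat.Combinatorics using (_C_; nC1≡n; nCk+nC[k+1]≡[n+1]C[k+1]; k>n⇒nCk≡0)
import Data.Nat.Properties as ℕ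
import Data.Nat.Tactic.RingSolver as ℕ-Solver
open import Data.Nat.Properties using (_!≢0)
open import Data.Nat.Divisibility using (_∣_; ∣-refl; ∣n⇒∣m*n)
open import Data.Nat.DivMod using (m/n*n≡m)
import Data.Rational as ℚ
import Data.Rational.Properties as ℚ
import Data.Rational.Unnormalised as ℚᵘ
import Data.Rational.Unnormalised.Properties as ℚᵘ
import Data.Vec as Vec
import Data.Vec.Functional as Vector
import Data.Vec.Functional.Properties as VectorProperties
open import Data.Product using (_,_)
open import Function using (_∘_; id; case_of_)
open import Relation.Binary.PropositionalEquality
  using (refl; sym; trans; cong; cong₂; subst; _≗_; module ≡-Reasoning)
open import Relation.Nullary.Decidable using (⌊_⌋; yes; no; isYes≗does; dec-true; dec-false)

module ∑ = SemiringSum ℤ.+-*-semiring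
module ∑ℕ = SemiringSum ℕ.+-*-semiring
module ⋀ = CommutativeMonoidSum Bool.∧-commutativeMonoid
open ∑ using (sum-syntax)

sumOf : ∀ {A : Set} → List A → (A → ℤ) → ℤ
sumOf xs F = sumℤ (map F xs)

sumℤ-++ : ∀ xs ys → sumℤ (xs ++ ys) ≡ sumℤ xs +ℤ sumℤ ys
sumℤ-++ []       ys = sym (ℤ.+-identityˡ _)
sumℤ-++ (x ∷ xs) ys = trans (cong (x +ℤ_) (sumℤ-++ xs ys)) (sym (ℤ.+-assoc x _ _))

sumℤ-concatMap : ∀ {A : Set} (xs : List A) (f : A → List ℤ) →
  sumℤ (concatMap f xs) ≡ sumOf xs (sumℤ ∘ f)
sumℤ-concatMap []       f = refl
sumℤ-concatMap (x ∷ xs) f =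
  trans (sumℤ-++ (f x) _) (cong (sumℤ (f x) +ℤ_) (sumℤ-concatMap xs f))

sumOf-concatMap : ∀ {A B : Set} (xs : List A) (f : A → List B) (F : B → ℤ) →
  sumOf (concatMap f xs) F ≡ sumOf xs (λ x → sumOf (f x) F)
sumOf-concatMap xs f F = begin
  sumℤ (map F (concatMap f xs))       ≡⟨ cong sumℤ (List.map-concatMap F f xs) ⟩
  sumℤ (concatMap (map F ∘ f) xs)     ≡⟨ sumℤ-concatMap xs (map F ∘ f) ⟩
  sumOf xs (λ x → sumOf (f x) F)      ∎
  where open ≡-Reasoning

sumOf-map : ∀ {A B : Set} (xs : List A) (g : A → B) (F : B → ℤ) → sumOf (map g xs) F ≡ sumOf xs (F ∘ g)
sumOf-map xs g F = cong sumℤ (sym (List.map-∘ xs))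

sumOf-cong : ∀ {A : Set} (xs : List A) {F G : A → ℤ} → F ≗ G → sumOf xs F ≡ sumOf xs G
sumOf-cong xs F≗G = cong sumℤ (List.map-cong F≗G xs)

sumOf-+ : ∀ {A : Set} (xs : List A) (F G : A → ℤ) →
  sumOf xs (λ x → F x +ℤ G x) ≡ sumOf xs F +ℤ sumOf xs G
sumOf-+ []       F G = refl
sumOf-+ (x ∷ xs) F G = trans (cong (F x +ℤ G x +ℤ_) (sumOf-+ xs F G)) (interchange (F x) (G x) _ _)
  where
  interchange : ∀ a b c d → a +ℤ b +ℤ (c +ℤ d) ≡ a +ℤ c +ℤ (b +ℤ d)
  interchange = solve-∀

sumOf-*ˡ : ∀ {A : Set} (xs : List A) (c : ℤ) (F : A → ℤ) → sumOf xs (λ x → c *ℤ F x) ≡ c *ℤ sumOf xs F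
sumOf-*ˡ []       c F = sym (ℤ.*-zeroʳ c)
sumOf-*ˡ (x ∷ xs) c F = trans (cong (c *ℤ F x +ℤ_) (sumOf-*ˡ xs c F)) (sym (ℤ.*-distribˡ-+ c (F x) _))

sumOf-zero : ∀ {A : Set} (xs : List A) {F : A → ℤ} → (∀ x → F x ≡ + 0) → sumOf xs F ≡ + 0
sumOf-zero []       F≡0 = refl
sumOf-zero (x ∷ xs) F≡0 = cong₂ _+ℤ_ (F≡0 x) (sumOf-zero xs F≡0)

sumOf-∑ : ∀ {A : Set} {k} (xs : List A) (F : A → Fin k → ℤ) →
  sumOf xs (λ x → ∑[ i < k ] F x i) ≡ ∑[ i < k ] sumOf xs (λ x → F x i)
sumOf-∑ {k = k} []       F = sym (∑.sum-replicate-zero k)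
sumOf-∑         (x ∷ xs) F =
  trans (cong (∑.sum (F x) +ℤ_) (sumOf-∑ xs F)) (sym (∑.∑-distrib-+ (F x) (λ i → sumOf xs (λ x → F x i))))

indicator : Bool → ℤ
indicator true  = + 1
indicator false = + 0

sumOf-filterᵇ : ∀ {A : Set} (p : A → Bool) (xs : List A) (F : A → ℤ) →
  sumOf (List.filterᵇ p xs) F ≡ sumOf xs (λ x → indicator (p x) *ℤ F x)
sumOf-filterᵇ p []       F = refl
sumOf-filterᵇ p (x ∷ xs) F with p x
... | true  = cong₂ _+ℤ_ (sym (ℤ.*-identityˡ (F x))) (sumOf-filterᵇ p xs F)
... | false = trans (sumOf-filterᵇ p xs F) (sym (ℤ.+-identityˡ _))

sumOf-upTo-suc : ∀ m (G : ℕ → ℤ) → sumOf (List.upTo (suc m)) G ≡ G 0 +ℤ sumOf (List.upTo m) (G ∘ suc)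
sumOf-upTo-suc m G = cong (G 0 +ℤ_) (begin
  sumOf (applyUpTo suc m) G            ≡⟨ cong (λ xs → sumOf xs G) (sym (List.map-upTo suc m)) ⟩
  sumOf (map suc (List.upTo m)) G      ≡⟨ sumOf-map (List.upTo m) suc G ⟩
  sumOf (List.upTo m) (G ∘ suc)        ∎)
  where open ≡-Reasoning

sumOf-upTo-last : ∀ m (G : ℕ → ℤ) → sumOf (List.upTo (suc m)) G ≡ sumOf (List.upTo m) G +ℤ G m
sumOf-upTo-last m G = begin
  sumℤ (map G (List.upTo (suc m)))                 ≡⟨ cong (sumℤ ∘ map G) (sym (List.applyUpTo-∷ʳ id m)) ⟩
  sumℤ (map G (List.upTo m List.∷ʳ m))             ≡⟨ cong sumℤ (List.map-++ G (List.upTo m) [ m ]) ⟩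
  sumℤ (map G (List.upTo m) ++ [ G m ])            ≡⟨ sumℤ-++ (map G (List.upTo m)) [ G m ] ⟩
  sumOf (List.upTo m) G +ℤ (G m +ℤ + 0)            ≡⟨ cong (sumOf (List.upTo m) G +ℤ_) (ℤ.+-identityʳ (G m)) ⟩
  sumOf (List.upTo m) G +ℤ G m                     ∎
  where open ≡-Reasoning

sumOf-upTo-stagger : ∀ n (X Y : ℕ → ℤ) → X n ≡ + 0 → Y 0 ≡ + 0 →
  sumOf (List.upTo (suc n)) (λ K → X K +ℤ Y K) ≡ sumOf (List.upTo n) (λ K → X K +ℤ Y (suc K))
sumOf-upTo-stagger n X Y Xₙ≡0 Y₀≡0 = begin
  sumOf (List.upTo (suc n)) (λ K → X K +ℤ Y K)
    ≡⟨ sumOf-+ (List.upTo (suc n)) X Y ⟩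
  sumOf (List.upTo (suc n)) X +ℤ sumOf (List.upTo (suc n)) Y
    ≡⟨ cong₂ _+ℤ_ (sumOf-upTo-last n X) (sumOf-upTo-suc n Y) ⟩
  (sumOf (List.upTo n) X +ℤ X n) +ℤ (Y 0 +ℤ sumOf (List.upTo n) (Y ∘ suc))
    ≡⟨ cong₂ (λ x y → (sumOf (List.upTo n) X +ℤ x) +ℤ (y +ℤ sumOf (List.upTo n) (Y ∘ suc))) Xₙ≡0 Y₀≡0 ⟩
  (sumOf (List.upTo n) X +ℤ + 0) +ℤ (+ 0 +ℤ sumOf (List.upTo n) (Y ∘ suc))
    ≡⟨ cong₂ _+ℤ_ (ℤ.+-identityʳ (sumOf (List.upTo n) X)) (ℤ.+-identityˡ (sumOf (List.upTo n) (Y ∘ suc))) ⟩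
  sumOf (List.upTo n) X +ℤ sumOf (List.upTo n) (Y ∘ suc)
    ≡⟨ sym (sumOf-+ (List.upTo n) X (Y ∘ suc)) ⟩
  sumOf (List.upTo n) (λ K → X K +ℤ Y (suc K))  ∎
  where open ≡-Reasoning

foldr-tabulate : ∀ {A B C : Set} {k} (f : A → B → B) (e : B) (h : C → A) (G : Fin k → C) →
  foldr (λ c → f (h c)) e (tabulate G) ≡ Vector.foldr f e (h ∘ G)
foldr-tabulate {k = zero}  f e h G = refl
foldr-tabulate {k = suc k} f e h G = cong (f (h (G Fin.zero))) (foldr-tabulate f e h (G ∘ Fin.suc))

sumOf-allFin : ∀ {k} (G : Fin k → ℤ) → sumOf (allFin k) G ≡ ∑[ i < k ] G i
sumOf-allFin G = trans (List.foldr-map _+ℤ_ G (+ 0) (allFin _)) (foldr-tabulate _+ℤ_ (+ 0) G id)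

∑-const : ∀ k (c : ℤ) → ∑[ i < k ] c ≡ + k *ℤ c
∑-const zero    c = sym (ℤ.*-zeroˡ c)
∑-const (suc k) c = begin
  c +ℤ ∑[ i < k ] c   ≡⟨ cong (c +ℤ_) (∑-const k c) ⟩
  c +ℤ + k *ℤ c       ≡⟨ sym (ℤ.suc-* (+ k) c) ⟩
  + suc k *ℤ c        ∎
  where open ≡-Reasoning

pos-∑ : ∀ {k} (G : Fin k → ℕ) → + ∑ℕ.sum G ≡ ∑[ i < k ] (+ G i)
pos-∑ {zero}  G = refl
pos-∑ {suc k} G = trans (ℤ.pos-+ (G Fin.zero) _) (cong (+ G Fin.zero +ℤ_) (pos-∑ (G ∘ Fin.suc)))

∑ℕ-≥-length : ∀ {k} (G : Fin k → ℕ) → (∀ j → 1 ≤ G j) → k ≤ ∑ℕ.sum G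
∑ℕ-≥-length {zero}  G G≥1 = z≤n
∑ℕ-≥-length {suc k} G G≥1 = ℕ.+-mono-≤ (G≥1 Fin.zero) (∑ℕ-≥-length (G ∘ Fin.suc) (G≥1 ∘ Fin.suc))

-- Block sizes and block sums of a map into Fin k

≟-diag : ∀ {k} (i : Fin k) → ⌊ i Fin.≟ i ⌋ ≡ true
≟-diag i = trans (isYes≗does (i Fin.≟ i)) (dec-true (i Fin.≟ i) refl)

≟-punchInˡ : ∀ {k} (i : Fin (suc k)) (y : Fin k) → ⌊ punchIn i y Fin.≟ i ⌋ ≡ false
≟-punchInˡ i y = trans (isYes≗does (punchIn i y Fin.≟ i)) (dec-false (punchIn i y Fin.≟ i) (Fin.punchInᵢ≢i i y))

≟-punchInʳ : ∀ {k} (i : Fin (suc k)) (y : Fin k) → ⌊ i Fin.≟ punchIn i y ⌋ ≡ false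
≟-punchInʳ i y = trans (isYes≗does (i Fin.≟ punchIn i y)) (dec-false (i Fin.≟ punchIn i y) (Fin.punchInᵢ≢i i y ∘ sym))

≟-punchIn : ∀ {k} (i : Fin (suc k)) (x y : Fin k) → ⌊ punchIn i x Fin.≟ punchIn i y ⌋ ≡ ⌊ x Fin.≟ y ⌋
≟-punchIn i x y with x Fin.≟ y
... | yes refl = ≟-diag (punchIn i x)
... | no  x≢y  = trans (isYes≗does _) (dec-false (punchIn i x Fin.≟ punchIn i y) (x≢y ∘ Fin.punchIn-injective i x y))

single : ∀ {k} → Fin k → ℕ → Fin k → ℕ
single i v j = if ⌊ i Fin.≟ j ⌋ then v else 0

∑ℕ-single : ∀ {k} (i : Fin k) (v : ℕ) → ∑ℕ.sum (single i v) ≡ v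
∑ℕ-single {suc k} i v = begin
  ∑ℕ.sum (single i v)                                   ≡⟨ ∑ℕ.sum-remove (single i v) ⟩
  single i v i + ∑ℕ.sum (single i v ∘ punchIn i)        ≡⟨ cong₂ _+_ (cong (if_then v else 0) (≟-diag i))
                                                              (∑ℕ.sum-cong-≗ (cong (if_then v else 0) ∘ ≟-punchInʳ i)) ⟩
  v + ∑ℕ.sum {k} (λ _ → 0)                              ≡⟨ cong (λ r → v + r) (∑ℕ.sum-replicate-zero k) ⟩
  v + 0                                                 ≡⟨ ℕ.+-identityʳ v ⟩
  v                                                     ∎
  where open ≡-Reasoning

blockSize-∷ʳ : ∀ {k m} (f : Vec (Fin k) m) i j → blockSize (f ∷ʳ i) j ≡ blockSize f j + single i 1 j
blockSize-∷ʳ []      i j = ℕ.+-identityʳ _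
blockSize-∷ʳ (x ∷ f) i j =
  trans (cong (λ r → single x 1 j + r) (blockSize-∷ʳ f i j)) (sym (ℕ.+-assoc (single x 1 j) _ _))

blockSum-∷ʳ : ∀ {k m} (f : Vec (Fin k) m) (a : Vec ℕ m) i v j →
  blockSum (f ∷ʳ i) (a ∷ʳ v) j ≡ blockSum f a j + single i v j
blockSum-∷ʳ []      []      i v j = ℕ.+-identityʳ _
blockSum-∷ʳ (x ∷ f) (y ∷ a) i v j =
  trans (cong (λ r → single x y j + r) (blockSum-∷ʳ f a i v j)) (sym (ℕ.+-assoc (single x y j) _ _))

∑-blockSize : ∀ {k m} (f : Vec (Fin k) m) → ∑ℕ.sum (blockSize f) ≡ m
∑-blockSize {k} []              = ∑ℕ.sum-replicate-zero k
∑-blockSize {m = suc m} (x ∷ f) = begin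
  ∑ℕ.sum (λ j → single x 1 j + blockSize f j)        ≡⟨ ∑ℕ.∑-distrib-+ (single x 1) (blockSize f) ⟩
  ∑ℕ.sum (single x 1) + ∑ℕ.sum (blockSize f)        ≡⟨ cong₂ _+_ (∑ℕ-single x 1) (∑-blockSize f) ⟩
  1 + m                                              ∎
  where open ≡-Reasoning

∑-blockSum : ∀ {k m} (f : Vec (Fin k) m) (a : Vec ℕ m) → ∑ℕ.sum (blockSum f a) ≡ sum a
∑-blockSum {k} []      []      = ∑ℕ.sum-replicate-zero k
∑-blockSum     (x ∷ f) (y ∷ a) = begin
  ∑ℕ.sum (λ j → single x y j + blockSum f a j)       ≡⟨ ∑ℕ.∑-distrib-+ (single x y) (blockSum f a) ⟩
  ∑ℕ.sum (single x y) + ∑ℕ.sum (blockSum f a)       ≡⟨ cong₂ _+_ (∑ℕ-single x y) (∑-blockSum f a) ⟩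
  y + sum a                                          ∎
  where open ≡-Reasoning

blockSize-punchIn : ∀ {K m} (h : Vec (Fin K) m) (i : Fin (suc K)) y →
  blockSize (Vec.map (punchIn i) h) (punchIn i y) ≡ blockSize h y
blockSize-punchIn []      i y = refl
blockSize-punchIn (x ∷ h) i y =
  cong₂ _+_ (cong (if_then 1 else 0) (≟-punchIn i x y)) (blockSize-punchIn h i y)

blockSize-punchIn-hole : ∀ {K m} (h : Vec (Fin K) m) (i : Fin (suc K)) → blockSize (Vec.map (punchIn i) h) i ≡ 0
blockSize-punchIn-hole []      i = refl
blockSize-punchIn-hole (x ∷ h) i =
  cong₂ _+_ (cong (if_then 1 else 0) (≟-punchInˡ i x)) (blockSize-punchIn-hole h i)

blockSum-punchIn : ∀ {K m} (h : Vec (Fin K) m) (a : Vec ℕ m) (i : Fin (suc K)) y →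
  blockSum (Vec.map (punchIn i) h) a (punchIn i y) ≡ blockSum h a y
blockSum-punchIn []      []      i y = refl
blockSum-punchIn (x ∷ h) (z ∷ a) i y =
  cong₂ _+_ (cong (if_then z else 0) (≟-punchIn i x y)) (blockSum-punchIn h a i y)

blockSum-punchIn-hole : ∀ {K m} (h : Vec (Fin K) m) (a : Vec ℕ m) (i : Fin (suc K)) →
  blockSum (Vec.map (punchIn i) h) a i ≡ 0
blockSum-punchIn-hole []      []      i = refl
blockSum-punchIn-hole (x ∷ h) (z ∷ a) i =
  cong₂ _+_ (cong (if_then z else 0) (≟-punchInˡ i x)) (blockSum-punchIn-hole h a i)

allBlocksNonempty-∧ : ∀ {k m} (f : Vec (Fin k) m) → allBlocksNonempty f ≡ ⋀.sum (λ j → 1 ≤ᵇ blockSize f j)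
allBlocksNonempty-∧ f = foldr-tabulate _∧_ true (λ j → 1 ≤ᵇ blockSize f j) id

allBlocksNonempty-remove : ∀ {K m} (f : Vec (Fin (suc K)) m) i →
  allBlocksNonempty f ≡ (1 ≤ᵇ blockSize f i) ∧ ⋀.sum (λ y → 1 ≤ᵇ blockSize f (punchIn i y))
allBlocksNonempty-remove f i = trans (allBlocksNonempty-∧ f) (⋀.sum-remove (λ j → 1 ≤ᵇ blockSize f j))

allBlocksNonempty-hole : ∀ {k m} (f : Vec (Fin k) m) i → blockSize f i ≡ 0 → allBlocksNonempty f ≡ false
allBlocksNonempty-hole {suc K} f i empty rewrite allBlocksNonempty-remove f i | empty = refl

allBlocksNonempty⇒nonempty : ∀ {k m} (f : Vec (Fin k) m) →
  allBlocksNonempty f ≡ true → ∀ j → 1 ≤ blockSize f j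
allBlocksNonempty⇒nonempty f all j with blockSize f j in size
... | suc _ = s≤s z≤n
... | zero  = case trans (sym (allBlocksNonempty-hole f j size)) all of λ ()

allBlocksNonempty⇒≤ : ∀ {k m} (f : Vec (Fin k) m) → allBlocksNonempty f ≡ true → k ≤ m
allBlocksNonempty⇒≤ {k} f all =
  subst (k ≤_) (∑-blockSize f) (∑ℕ-≥-length (blockSize f) (allBlocksNonempty⇒nonempty f all))

allBlocksNonempty-∷ʳ : ∀ {k m} (f : Vec (Fin k) m) i → 1 ≤ blockSize f i →
  allBlocksNonempty (f ∷ʳ i) ≡ allBlocksNonempty f
allBlocksNonempty-∷ʳ f i i-nonempty = begin
  allBlocksNonempty (f ∷ʳ i)                  ≡⟨ allBlocksNonempty-∧ (f ∷ʳ i) ⟩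
  ⋀.sum (λ j → 1 ≤ᵇ blockSize (f ∷ʳ i) j)     ≡⟨ ⋀.sum-cong-≗ nonempty-∷ʳ ⟩
  ⋀.sum (λ j → 1 ≤ᵇ blockSize f j)            ≡⟨ sym (allBlocksNonempty-∧ f) ⟩
  allBlocksNonempty f                         ∎
  where
  open ≡-Reasoning
  nonempty-∷ʳ : ∀ j → (1 ≤ᵇ blockSize (f ∷ʳ i) j) ≡ (1 ≤ᵇ blockSize f j)
  nonempty-∷ʳ j rewrite blockSize-∷ʳ f i j with i Fin.≟ j
  ... | yes refl = positive (blockSize f i) i-nonempty
    where
    positive : ∀ n → 1 ≤ n → (1 ≤ᵇ n + 1) ≡ (1 ≤ᵇ n)
    positive (suc _) _ = refl
  ... | no _     = cong (1 ≤ᵇ_) (ℕ.+-identityʳ (blockSize f j))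

insert : ∀ {K m} → Vec (Fin K) m → Fin (suc K) → Vec (Fin (suc K)) (suc m)
insert h i = Vec.map (punchIn i) h ∷ʳ i

blockSize-insert-hole : ∀ {K m} (h : Vec (Fin K) m) (i : Fin (suc K)) → blockSize (insert h i) i ≡ 1
blockSize-insert-hole h i = trans (blockSize-∷ʳ (Vec.map (punchIn i) h) i i)
  (cong₂ _+_ (blockSize-punchIn-hole h i) (cong (if_then 1 else 0) (≟-diag i)))

blockSize-insert : ∀ {K m} (h : Vec (Fin K) m) (i : Fin (suc K)) y →
  blockSize (insert h i) (punchIn i y) ≡ blockSize h y
blockSize-insert h i y = trans (blockSize-∷ʳ (Vec.map (punchIn i) h) i (punchIn i y))
  (trans (cong₂ _+_ (blockSize-punchIn h i y) (cong (if_then 1 else 0) (≟-punchInʳ i y))) (ℕ.+-identityʳ _))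

blockSum-insert-hole : ∀ {K m} (h : Vec (Fin K) m) (a : Vec ℕ m) (i : Fin (suc K)) v →
  blockSum (insert h i) (a ∷ʳ v) i ≡ v
blockSum-insert-hole h a i v = trans (blockSum-∷ʳ (Vec.map (punchIn i) h) a i v i)
  (cong₂ _+_ (blockSum-punchIn-hole h a i) (cong (if_then v else 0) (≟-diag i)))

blockSum-insert : ∀ {K m} (h : Vec (Fin K) m) (a : Vec ℕ m) (i : Fin (suc K)) v y →
  blockSum (insert h i) (a ∷ʳ v) (punchIn i y) ≡ blockSum h a y
blockSum-insert h a i v y = trans (blockSum-∷ʳ (Vec.map (punchIn i) h) a i v (punchIn i y))
  (trans (cong₂ _+_ (blockSum-punchIn h a i y) (cong (if_then v else 0) (≟-punchInʳ i y))) (ℕ.+-identityʳ _))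

allBlocksNonempty-insert : ∀ {K m} (h : Vec (Fin K) m) (i : Fin (suc K)) →
  allBlocksNonempty (insert h i) ≡ allBlocksNonempty h
allBlocksNonempty-insert h i = begin
  allBlocksNonempty f                                              ≡⟨ allBlocksNonempty-remove f i ⟩
  (1 ≤ᵇ blockSize f i) ∧ ⋀.sum (λ y → 1 ≤ᵇ blockSize f (punchIn i y))
    ≡⟨ cong₂ (λ s t → (1 ≤ᵇ s) ∧ t) (blockSize-insert-hole h i)
                                    (⋀.sum-cong-≗ (cong (1 ≤ᵇ_) ∘ blockSize-insert h i)) ⟩
  ⋀.sum (λ y → 1 ≤ᵇ blockSize h y)                                 ≡⟨ sym (allBlocksNonempty-∧ h) ⟩
  allBlocksNonempty h                                              ∎
  where
  open ≡-Reasoning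
  f = insert h i

-- f ∷ʳ i has all blocks nonempty iff f does, or i is the one block that f misses.
indicator-allBlocksNonempty-∷ʳ : ∀ {k m} (f : Vec (Fin k) m) i →
  indicator (allBlocksNonempty (f ∷ʳ i))
    ≡ indicator (allBlocksNonempty f) +ℤ indicator (blockSize f i ℕ.≡ᵇ 0) *ℤ indicator (allBlocksNonempty (f ∷ʳ i))
indicator-allBlocksNonempty-∷ʳ f i with blockSize f i in size
... | suc _ = trans (cong indicator (allBlocksNonempty-∷ʳ f i (subst (1 ≤_) (sym size) (s≤s z≤n))))
                    (sym (ℤ.+-identityʳ _))
... | zero  = begin
  indicator (allBlocksNonempty (f ∷ʳ i))          ≡⟨ sym (ℤ.+-identityˡ _) ⟩
  + 0 +ℤ indicator (allBlocksNonempty (f ∷ʳ i))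
    ≡⟨ cong₂ _+ℤ_ (cong indicator (sym (allBlocksNonempty-hole f i size))) (sym (ℤ.*-identityˡ _)) ⟩
  indicator (allBlocksNonempty f) +ℤ + 1 *ℤ indicator (allBlocksNonempty (f ∷ʳ i)) ∎
  where open ≡-Reasoning

sumOf-allMaps-suc : ∀ k m (G : Vec (Fin k) (suc m) → ℤ) →
  sumOf (allMaps k (suc m)) G ≡ ∑[ x < k ] sumOf (allMaps k m) (G ∘ (x ∷_))
sumOf-allMaps-suc k m G = begin
  sumOf (allMaps k (suc m)) G
    ≡⟨ sumOf-concatMap (allFin k) _ G ⟩
  sumOf (allFin k) (λ x → sumOf (map (x ∷_) (allMaps k m)) G)
    ≡⟨ sumOf-cong (allFin k) (λ x → sumOf-map (allMaps k m) (x ∷_) G) ⟩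
  sumOf (allFin k) (λ x → sumOf (allMaps k m) (G ∘ (x ∷_)))
    ≡⟨ sumOf-allFin {k} _ ⟩
  ∑[ x < k ] sumOf (allMaps k m) (G ∘ (x ∷_))  ∎
  where open ≡-Reasoning

sumOf-allMaps-∷ʳ : ∀ k m (G : Vec (Fin k) (suc m) → ℤ) →
  sumOf (allMaps k (suc m)) G ≡ sumOf (allMaps k m) (λ f → ∑[ i < k ] G (f ∷ʳ i))
sumOf-allMaps-∷ʳ k zero    G = begin
  sumOf (allMaps k 1) G                 ≡⟨ sumOf-allMaps-suc k 0 G ⟩
  ∑[ i < k ] (G (i ∷ []) +ℤ + 0)        ≡⟨ ∑.sum-cong-≗ (λ i → ℤ.+-identityʳ (G (i ∷ []))) ⟩
  ∑[ i < k ] G (i ∷ [])                 ≡⟨ sym (ℤ.+-identityʳ _) ⟩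
  ∑[ i < k ] G (i ∷ []) +ℤ + 0          ∎
  where open ≡-Reasoning
sumOf-allMaps-∷ʳ k (suc m) G = begin
  sumOf (allMaps k (suc (suc m))) G
    ≡⟨ sumOf-allMaps-suc k (suc m) G ⟩
  ∑[ x < k ] sumOf (allMaps k (suc m)) (G ∘ (x ∷_))
    ≡⟨ ∑.sum-cong-≗ (λ x → sumOf-allMaps-∷ʳ k m (G ∘ (x ∷_))) ⟩
  ∑[ x < k ] sumOf (allMaps k m) (λ f → ∑[ i < k ] G (x ∷ (f ∷ʳ i)))
    ≡⟨ sym (sumOf-allMaps-suc k m (λ f → ∑[ i < k ] G (f ∷ʳ i))) ⟩
  sumOf (allMaps k (suc m)) (λ f → ∑[ i < k ] G (f ∷ʳ i))                ∎
  where open ≡-Reasoning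

-- Maps missing the block i are exactly the maps into the other K blocks, relabelled by punchIn i.
sumOf-allMaps-hole : ∀ K m (i : Fin (suc K)) (G : Vec (Fin (suc K)) m → ℤ) →
  sumOf (allMaps (suc K) m) (λ f → indicator (blockSize f i ℕ.≡ᵇ 0) *ℤ G f)
    ≡ sumOf (allMaps K m) (G ∘ Vec.map (punchIn i))
sumOf-allMaps-hole K zero    i G = cong (_+ℤ + 0) (ℤ.*-identityˡ (G []))
sumOf-allMaps-hole K (suc m) i G = begin
  sumOf (allMaps (suc K) (suc m)) (λ f → missing f *ℤ G f)
    ≡⟨ sumOf-allMaps-suc (suc K) m _ ⟩
  ∑[ x < suc K ] sumOf (allMaps (suc K) m) (λ f → missing (x ∷ f) *ℤ G (x ∷ f))
    ≡⟨ ∑.sum-remove {i = i} (λ x → sumOf (allMaps (suc K) m) (λ f → missing (x ∷ f) *ℤ G (x ∷ f))) ⟩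
  sumOf (allMaps (suc K) m) (λ f → missing (i ∷ f) *ℤ G (i ∷ f))
    +ℤ ∑[ y < K ] sumOf (allMaps (suc K) m) (λ f → missing (punchIn i y ∷ f) *ℤ G (punchIn i y ∷ f))
    ≡⟨ cong₂ _+ℤ_ (sumOf-zero (allMaps (suc K) m) (λ f → cong (_*ℤ G (i ∷ f)) (missing-i f)))
                  (∑.sum-cong-≗ (λ y → sumOf-cong (allMaps (suc K) m)
                                                  (λ f → cong (_*ℤ G (punchIn i y ∷ f)) (missing-punchIn y f)))) ⟩
  + 0 +ℤ ∑[ y < K ] sumOf (allMaps (suc K) m) (λ f → missing f *ℤ G (punchIn i y ∷ f))
    ≡⟨ ℤ.+-identityˡ _ ⟩
  ∑[ y < K ] sumOf (allMaps (suc K) m) (λ f → missing f *ℤ G (punchIn i y ∷ f))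
    ≡⟨ ∑.sum-cong-≗ (λ y → sumOf-allMaps-hole K m i (G ∘ (punchIn i y ∷_))) ⟩
  ∑[ y < K ] sumOf (allMaps K m) (λ h → G (Vec.map (punchIn i) (y ∷ h)))
    ≡⟨ sym (sumOf-allMaps-suc K m (G ∘ Vec.map (punchIn i))) ⟩
  sumOf (allMaps K (suc m)) (G ∘ Vec.map (punchIn i))  ∎
  where
  open ≡-Reasoning
  missing : ∀ {m} → Vec (Fin (suc K)) m → ℤ
  missing f = indicator (blockSize f i ℕ.≡ᵇ 0)
  missing-i : ∀ {m} (f : Vec (Fin (suc K)) m) → missing (i ∷ f) ≡ + 0
  missing-i f = cong (λ s → indicator ((s + blockSize f i) ℕ.≡ᵇ 0)) (cong (if_then 1 else 0) (≟-diag i))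
  missing-punchIn : ∀ {m} y (f : Vec (Fin (suc K)) m) → missing (punchIn i y ∷ f) ≡ missing f
  missing-punchIn y f = cong (λ s → indicator ((s + blockSize f i) ℕ.≡ᵇ 0)) (cong (if_then 1 else 0) (≟-punchInˡ i y))

-- Coefficient sequences and their convolution

Series : Set
Series = ℕ → ℤ

antidiagonal : (ℕ → ℕ → ℤ) → Series
antidiagonal F zero    = F 0 0
antidiagonal F (suc E) = F 0 (suc E) +ℤ antidiagonal (λ d e → F (suc d) e) E

antidiagonal-cong : ∀ {F G : ℕ → ℕ → ℤ} → (∀ d e → F d e ≡ G d e) → antidiagonal F ≗ antidiagonal G
antidiagonal-cong F≡G zero    = F≡G 0 0
antidiagonal-cong F≡G (suc E) = cong₂ _+ℤ_ (F≡G 0 (suc E)) (antidiagonal-cong (λ d → F≡G (suc d)) E)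

antidiagonal-+ : ∀ (F G : ℕ → ℕ → ℤ) E →
  antidiagonal (λ d e → F d e +ℤ G d e) E ≡ antidiagonal F E +ℤ antidiagonal G E
antidiagonal-+ F G zero    = refl
antidiagonal-+ F G (suc E) =
  trans (cong (F 0 (suc E) +ℤ G 0 (suc E) +ℤ_) (antidiagonal-+ (λ d → F (suc d)) (λ d → G (suc d)) E))
        (interchange (F 0 (suc E)) (G 0 (suc E)) _ _)
  where
  interchange : ∀ a b c d → a +ℤ b +ℤ (c +ℤ d) ≡ a +ℤ c +ℤ (b +ℤ d)
  interchange = solve-∀

antidiagonal-*ˡ : ∀ (c : ℤ) (F : ℕ → ℕ → ℤ) E → antidiagonal (λ d e → c *ℤ F d e) E ≡ c *ℤ antidiagonal F E
antidiagonal-*ˡ c F zero    = refl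
antidiagonal-*ˡ c F (suc E) =
  trans (cong (c *ℤ F 0 (suc E) +ℤ_) (antidiagonal-*ˡ c (λ d → F (suc d)) E)) (sym (ℤ.*-distribˡ-+ c _ _))

antidiagonal-*ʳ : ∀ (c : ℤ) (F : ℕ → ℕ → ℤ) E → antidiagonal (λ d e → F d e *ℤ c) E ≡ antidiagonal F E *ℤ c
antidiagonal-*ʳ c F E = begin
  antidiagonal (λ d e → F d e *ℤ c) E   ≡⟨ antidiagonal-cong (λ d e → ℤ.*-comm (F d e) c) E ⟩
  antidiagonal (λ d e → c *ℤ F d e) E   ≡⟨ antidiagonal-*ˡ c F E ⟩
  c *ℤ antidiagonal F E                 ≡⟨ ℤ.*-comm c _ ⟩
  antidiagonal F E *ℤ c                 ∎
  where open ≡-Reasoning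

antidiagonal-zero : ∀ {F : ℕ → ℕ → ℤ} → (∀ d e → F d e ≡ + 0) → ∀ E → antidiagonal F E ≡ + 0
antidiagonal-zero F≡0 zero    = F≡0 0 0
antidiagonal-zero F≡0 (suc E) = cong₂ _+ℤ_ (F≡0 0 (suc E)) (antidiagonal-zero (λ d → F≡0 (suc d)) E)

antidiagonal-last : ∀ (F : ℕ → ℕ → ℤ) E →
  antidiagonal F (suc E) ≡ antidiagonal (λ d e → F d (suc e)) E +ℤ F (suc E) 0
antidiagonal-last F zero    = refl
antidiagonal-last F (suc E) =
  trans (cong (F 0 (suc (suc E)) +ℤ_) (antidiagonal-last (λ d → F (suc d)) E))
        (sym (ℤ.+-assoc (F 0 (suc (suc E))) _ _))

antidiagonal-flip : ∀ (F : ℕ → ℕ → ℤ) → antidiagonal F ≗ antidiagonal (λ d e → F e d)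
antidiagonal-flip F zero    = refl
antidiagonal-flip F (suc E) = begin
  F 0 (suc E) +ℤ antidiagonal (λ d e → F (suc d) e) E   ≡⟨ cong (F 0 (suc E) +ℤ_) (antidiagonal-flip (λ d → F (suc d)) E) ⟩
  F 0 (suc E) +ℤ antidiagonal (λ d e → F (suc e) d) E   ≡⟨ ℤ.+-comm (F 0 (suc E)) _ ⟩
  antidiagonal (λ d e → F (suc e) d) E +ℤ F 0 (suc E)   ≡⟨ sym (antidiagonal-last (λ d e → F e d) E) ⟩
  antidiagonal (λ d e → F e d) (suc E)                  ∎
  where open ≡-Reasoning

-- Both sides are the sum of T d p q over d + p + q = E.
antidiagonal-assoc : ∀ (T : ℕ → ℕ → ℕ → ℤ) →
  antidiagonal (λ d e → antidiagonal (T d) e) ≗ antidiagonal (λ e q → antidiagonal (λ d p → T d p q) e)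
antidiagonal-assoc T zero    = refl
antidiagonal-assoc T (suc E) = begin
  antidiagonal (T 0) (suc E) +ℤ antidiagonal (λ d e → antidiagonal (T (suc d)) e) E
    ≡⟨ cong (antidiagonal (T 0) (suc E) +ℤ_) (antidiagonal-assoc (T ∘ suc) E) ⟩
  T 0 0 (suc E) +ℤ antidiagonal (λ p → T 0 (suc p)) E +ℤ antidiagonal (λ e q → antidiagonal (λ d p → T (suc d) p q) e) E
    ≡⟨ ℤ.+-assoc (T 0 0 (suc E)) _ _ ⟩
  T 0 0 (suc E) +ℤ (antidiagonal (λ p → T 0 (suc p)) E +ℤ antidiagonal (λ e q → antidiagonal (λ d p → T (suc d) p q) e) E)
    ≡⟨ cong (T 0 0 (suc E) +ℤ_)
            (sym (antidiagonal-+ (λ p → T 0 (suc p)) (λ e q → antidiagonal (λ d p → T (suc d) p q) e) E)) ⟩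
  antidiagonal (λ e q → antidiagonal (λ d p → T d p q) e) (suc E)  ∎
  where open ≡-Reasoning

-- The weight α + β (d + e) is constant on the antidiagonal d + e = E.
antidiagonal-affine : ∀ (α β : ℤ) (F : ℕ → ℕ → ℤ) E →
  antidiagonal (λ d e → (α +ℤ β *ℤ + (d + e)) *ℤ F d e) E ≡ (α +ℤ β *ℤ + E) *ℤ antidiagonal F E
antidiagonal-affine α β F zero    = refl
antidiagonal-affine α β F (suc E) = begin
  (α +ℤ β *ℤ + suc E) *ℤ F 0 (suc E) +ℤ antidiagonal (λ d e → (α +ℤ β *ℤ + (suc d + e)) *ℤ F (suc d) e) E
    ≡⟨ cong (head +ℤ_) (antidiagonal-cong (λ d e → cong (_*ℤ F (suc d) e) (shiftOrigin α β (+ (d + e)))) E) ⟩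
  (α +ℤ β *ℤ + suc E) *ℤ F 0 (suc E) +ℤ antidiagonal (λ d e → (α +ℤ β +ℤ β *ℤ + (d + e)) *ℤ F (suc d) e) E
    ≡⟨ cong (head +ℤ_) (antidiagonal-affine (α +ℤ β) β (λ d → F (suc d)) E) ⟩
  (α +ℤ β *ℤ + suc E) *ℤ F 0 (suc E) +ℤ (α +ℤ β +ℤ β *ℤ + E) *ℤ antidiagonal (λ d → F (suc d)) E
    ≡⟨ collect α β (+ E) (F 0 (suc E)) _ ⟩
  (α +ℤ β *ℤ + suc E) *ℤ (F 0 (suc E) +ℤ antidiagonal (λ d → F (suc d)) E)  ∎
  where
  open ≡-Reasoning
  head = (α +ℤ β *ℤ + suc E) *ℤ F 0 (suc E)
  shiftOrigin : ∀ α β x → α +ℤ β *ℤ (+ 1 +ℤ x) ≡ α +ℤ β +ℤ β *ℤ x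
  shiftOrigin = solve-∀
  collect : ∀ α β x y z → (α +ℤ β *ℤ (+ 1 +ℤ x)) *ℤ y +ℤ (α +ℤ β +ℤ β *ℤ x) *ℤ z
                        ≡ (α +ℤ β *ℤ (+ 1 +ℤ x)) *ℤ (y +ℤ z)
  collect = solve-∀

infixl 7 _⋆_

_⋆_ : Series → Series → Series
(f ⋆ g) = antidiagonal (λ d e → f d *ℤ g e)

𝟙 : Series
𝟙 zero    = + 1
𝟙 (suc _) = + 0

shift : Series → Series
shift f zero    = + 0
shift f (suc e) = f e

⋆-cong : ∀ {f f′ g g′} → f ≗ f′ → g ≗ g′ → f ⋆ g ≗ f′ ⋆ g′
⋆-cong f≗f′ g≗g′ = antidiagonal-cong (λ d e → cong₂ _*ℤ_ (f≗f′ d) (g≗g′ e))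

⋆-congʳ : ∀ f {g g′} → g ≗ g′ → f ⋆ g ≗ f ⋆ g′
⋆-congʳ f = ⋆-cong {f} (λ _ → refl)

⋆-comm : ∀ f g → f ⋆ g ≗ g ⋆ f
⋆-comm f g E = trans (antidiagonal-flip (λ d e → f d *ℤ g e) E) (antidiagonal-cong (λ d e → ℤ.*-comm (f e) (g d)) E)

⋆-assoc : ∀ f g h → f ⋆ (g ⋆ h) ≗ (f ⋆ g) ⋆ h
⋆-assoc f g h E = begin
  antidiagonal (λ d e → f d *ℤ antidiagonal (λ p q → g p *ℤ h q) e) E
    ≡⟨ antidiagonal-cong (λ d e → sym (antidiagonal-*ˡ (f d) (λ p q → g p *ℤ h q) e)) E ⟩
  antidiagonal (λ d e → antidiagonal (λ p q → f d *ℤ (g p *ℤ h q)) e) E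
    ≡⟨ antidiagonal-assoc (λ d p q → f d *ℤ (g p *ℤ h q)) E ⟩
  antidiagonal (λ e q → antidiagonal (λ d p → f d *ℤ (g p *ℤ h q)) e) E
    ≡⟨ antidiagonal-cong (λ e q → trans (antidiagonal-cong (λ d p → sym (ℤ.*-assoc (f d) (g p) (h q))) e)
                                        (antidiagonal-*ʳ (h q) (λ d p → f d *ℤ g p) e)) E ⟩
  antidiagonal (λ e q → antidiagonal (λ d p → f d *ℤ g p) e *ℤ h q) E  ∎
  where open ≡-Reasoning

⋆-exchange : ∀ f g h → f ⋆ (g ⋆ h) ≗ g ⋆ (f ⋆ h)
⋆-exchange f g h E = begin
  (f ⋆ (g ⋆ h)) E   ≡⟨ ⋆-assoc f g h E ⟩
  ((f ⋆ g) ⋆ h) E   ≡⟨ ⋆-cong (⋆-comm f g) (λ _ → refl) E ⟩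
  ((g ⋆ f) ⋆ h) E   ≡⟨ sym (⋆-assoc g f h E) ⟩
  (g ⋆ (f ⋆ h)) E   ∎
  where open ≡-Reasoning

⋆-distribˡ-+ : ∀ f g g′ E → (f ⋆ (λ e → g e +ℤ g′ e)) E ≡ (f ⋆ g) E +ℤ (f ⋆ g′) E
⋆-distribˡ-+ f g g′ E = trans (antidiagonal-cong (λ d e → ℤ.*-distribˡ-+ (f d) (g e) (g′ e)) E)
                              (antidiagonal-+ (λ d e → f d *ℤ g e) (λ d e → f d *ℤ g′ e) E)

⋆-distribʳ-+ : ∀ f f′ g E → ((λ e → f e +ℤ f′ e) ⋆ g) E ≡ (f ⋆ g) E +ℤ (f′ ⋆ g) E
⋆-distribʳ-+ f f′ g E = trans (antidiagonal-cong (λ d e → ℤ.*-distribʳ-+ (g e) (f d) (f′ d)) E)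
                              (antidiagonal-+ (λ d e → f d *ℤ g e) (λ d e → f′ d *ℤ g e) E)

⋆-zeroʳ : ∀ f → f ⋆ (λ _ → + 0) ≗ (λ _ → + 0)
⋆-zeroʳ f = antidiagonal-zero (λ d e → ℤ.*-zeroʳ (f d))

shift-⋆ : ∀ f g → shift f ⋆ g ≗ shift (f ⋆ g)
shift-⋆ f g zero    = refl
shift-⋆ f g (suc E) = ℤ.+-identityˡ _

⋆-shift : ∀ f g → f ⋆ shift g ≗ shift (f ⋆ g)
⋆-shift f g zero    = ℤ.*-zeroʳ (f 0)
⋆-shift f g (suc E) = begin
  (f ⋆ shift g) (suc E)                       ≡⟨ antidiagonal-last (λ d e → f d *ℤ shift g e) E ⟩
  (f ⋆ g) E +ℤ f (suc E) *ℤ + 0               ≡⟨ cong ((f ⋆ g) E +ℤ_) (ℤ.*-zeroʳ (f (suc E))) ⟩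
  (f ⋆ g) E +ℤ + 0                            ≡⟨ ℤ.+-identityʳ _ ⟩
  (f ⋆ g) E                                   ∎
  where open ≡-Reasoning

shift-+ : ∀ f g → (λ E → shift f E +ℤ shift g E) ≗ shift (λ e → f e +ℤ g e)
shift-+ f g zero    = refl
shift-+ f g (suc E) = refl

mulAffine : ℤ → ℤ → Series → Series
mulAffine α β h e = (α +ℤ β *ℤ + e) *ℤ h e

-- Multiplication by the exponent e is a derivation of the convolution algebra.
mulAffine-leibniz : ∀ α α′ β f g E →
  (mulAffine α β f ⋆ g) E +ℤ (f ⋆ mulAffine α′ β g) E ≡ mulAffine (α +ℤ α′) β (f ⋆ g) E
mulAffine-leibniz α α′ β f g E = begin
  (mulAffine α β f ⋆ g) E +ℤ (f ⋆ mulAffine α′ β g) E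
    ≡⟨ sym (antidiagonal-+ (λ d e → mulAffine α β f d *ℤ g e) (λ d e → f d *ℤ mulAffine α′ β g e) E) ⟩
  antidiagonal (λ d e → mulAffine α β f d *ℤ g e +ℤ f d *ℤ mulAffine α′ β g e) E
    ≡⟨ antidiagonal-cong (λ d e → trans (expand α α′ β (+ d) (+ e) (f d) (g e))
                                        (cong (λ x → (α +ℤ α′ +ℤ β *ℤ x) *ℤ (f d *ℤ g e)) (sym (ℤ.pos-+ d e)))) E ⟩
  antidiagonal (λ d e → (α +ℤ α′ +ℤ β *ℤ + (d + e)) *ℤ (f d *ℤ g e)) E
    ≡⟨ antidiagonal-affine (α +ℤ α′) β (λ d e → f d *ℤ g e) E ⟩
  mulAffine (α +ℤ α′) β (f ⋆ g) E  ∎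
  where
  open ≡-Reasoning
  expand : ∀ α α′ β x y u v → (α +ℤ β *ℤ x) *ℤ u *ℤ v +ℤ u *ℤ ((α′ +ℤ β *ℤ y) *ℤ v)
                            ≡ (α +ℤ α′ +ℤ β *ℤ (x +ℤ y)) *ℤ (u *ℤ v)
  expand = solve-∀

𝒟[_,_] : ℤ → ℤ → Series → Series
𝒟[ c , b ] h e = mulAffine c (+ 2) h e +ℤ shift (mulAffine b (- + 2) h) e

𝒟-cong : ∀ {c b h h′} → h ≗ h′ → 𝒟[ c , b ] h ≗ 𝒟[ c , b ] h′
𝒟-cong {c} {b} h≗h′ zero    = cong (λ x → (c +ℤ + 2 *ℤ + 0) *ℤ x +ℤ + 0) (h≗h′ 0)
𝒟-cong {c} {b} h≗h′ (suc E) =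
  cong₂ (λ x y → (c +ℤ + 2 *ℤ + suc E) *ℤ x +ℤ (b +ℤ - + 2 *ℤ + E) *ℤ y) (h≗h′ (suc E)) (h≗h′ E)

sumOf-𝒟 : ∀ {A : Set} (xs : List A) c b (H : A → Series) E →
  sumOf xs (λ x → 𝒟[ c , b ] (H x) (suc E)) ≡ 𝒟[ c , b ] (λ e → sumOf xs (λ x → H x e)) (suc E)
sumOf-𝒟 xs c b H E = begin
  sumOf xs (λ x → (c +ℤ + 2 *ℤ + suc E) *ℤ H x (suc E) +ℤ (b +ℤ - + 2 *ℤ + E) *ℤ H x E)
    ≡⟨ sumOf-+ xs _ _ ⟩
  sumOf xs (λ x → (c +ℤ + 2 *ℤ + suc E) *ℤ H x (suc E)) +ℤ sumOf xs (λ x → (b +ℤ - + 2 *ℤ + E) *ℤ H x E)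
    ≡⟨ cong₂ _+ℤ_ (sumOf-*ˡ xs (c +ℤ + 2 *ℤ + suc E) (λ x → H x (suc E)))
                  (sumOf-*ˡ xs (b +ℤ - + 2 *ℤ + E) (λ x → H x E)) ⟩
  𝒟[ c , b ] (λ e → sumOf xs (λ x → H x e)) (suc E)  ∎
  where open ≡-Reasoning

𝒟-leibniz : ∀ c c′ b b′ f g E →
  (𝒟[ c , b ] f ⋆ g) E +ℤ (f ⋆ 𝒟[ c′ , b′ ] g) E ≡ 𝒟[ c +ℤ c′ , b +ℤ b′ ] (f ⋆ g) E
𝒟-leibniz c c′ b b′ f g E = begin
  (𝒟[ c , b ] f ⋆ g) E +ℤ (f ⋆ 𝒟[ c′ , b′ ] g) E
    ≡⟨ cong₂ _+ℤ_ (trans (⋆-distribʳ-+ (mulAffine c (+ 2) f) (shift (mulAffine b (- + 2) f)) g E)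
                         (cong (x₁ +ℤ_) (shift-⋆ (mulAffine b (- + 2) f) g E)))
                  (trans (⋆-distribˡ-+ f (mulAffine c′ (+ 2) g) (shift (mulAffine b′ (- + 2) g)) E)
                         (cong (x₂ +ℤ_) (⋆-shift f (mulAffine b′ (- + 2) g) E))) ⟩
  (x₁ +ℤ y₁) +ℤ (x₂ +ℤ y₂)
    ≡⟨ interchange x₁ y₁ x₂ y₂ ⟩
  (x₁ +ℤ x₂) +ℤ (y₁ +ℤ y₂)
    ≡⟨ cong₂ _+ℤ_ (mulAffine-leibniz c c′ (+ 2) f g E)
                  (trans (shift-+ (mulAffine b (- + 2) f ⋆ g) (f ⋆ mulAffine b′ (- + 2) g) E) (shifted E)) ⟩
  𝒟[ c +ℤ c′ , b +ℤ b′ ] (f ⋆ g) E  ∎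
  where
  open ≡-Reasoning
  x₁ = (mulAffine c (+ 2) f ⋆ g) E
  y₁ = shift (mulAffine b (- + 2) f ⋆ g) E
  x₂ = (f ⋆ mulAffine c′ (+ 2) g) E
  y₂ = shift (f ⋆ mulAffine b′ (- + 2) g) E
  interchange : ∀ a b c d → (a +ℤ b) +ℤ (c +ℤ d) ≡ (a +ℤ c) +ℤ (b +ℤ d)
  interchange = solve-∀
  shifted : shift (λ e → (mulAffine b (- + 2) f ⋆ g) e +ℤ (f ⋆ mulAffine b′ (- + 2) g) e)
          ≗ shift (mulAffine (b +ℤ b′) (- + 2) (f ⋆ g))
  shifted zero    = refl
  shifted (suc E) = mulAffine-leibniz b b′ (- + 2) f g E

∏⋆ : ∀ {k} → (Fin k → Series) → Series
∏⋆ {zero}  W = 𝟙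
∏⋆ {suc k} W = W Fin.zero ⋆ ∏⋆ (W ∘ Fin.suc)

∏⋆-cong : ∀ {k} {W W′ : Fin k → Series} → (∀ j → W j ≗ W′ j) → ∏⋆ W ≗ ∏⋆ W′
∏⋆-cong {zero}  W≗W′ E = refl
∏⋆-cong {suc k} W≗W′   = ⋆-cong (W≗W′ Fin.zero) (∏⋆-cong (W≗W′ ∘ Fin.suc))

∏⋆-punchIn : ∀ {K} (i : Fin (suc K)) (W : Fin (suc K) → Series) → ∏⋆ W ≗ W i ⋆ ∏⋆ (W ∘ punchIn i)
∏⋆-punchIn Fin.zero          W E = refl
∏⋆-punchIn {suc K} (Fin.suc i) W E = begin
  (W Fin.zero ⋆ ∏⋆ (W ∘ Fin.suc)) E
    ≡⟨ ⋆-congʳ (W Fin.zero) (∏⋆-punchIn i (W ∘ Fin.suc)) E ⟩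
  (W Fin.zero ⋆ (W (Fin.suc i) ⋆ ∏⋆ (W ∘ Fin.suc ∘ punchIn i))) E
    ≡⟨ ⋆-exchange (W Fin.zero) (W (Fin.suc i)) _ E ⟩
  (W (Fin.suc i) ⋆ (W Fin.zero ⋆ ∏⋆ (W ∘ Fin.suc ∘ punchIn i))) E  ∎
  where open ≡-Reasoning

⋆-∑ : ∀ {k} f (X : Fin k → Series) → f ⋆ (λ e → ∑[ i < k ] X i e) ≗ (λ E → ∑[ i < k ] (f ⋆ X i) E)
⋆-∑ {zero}  f X = ⋆-zeroʳ f
⋆-∑ {suc k} f X E = trans (⋆-distribˡ-+ f (X Fin.zero) (λ e → ∑[ i < k ] X (Fin.suc i) e) E)
                          (cong ((f ⋆ X Fin.zero) E +ℤ_) (⋆-∑ f (X ∘ Fin.suc) E))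

𝒟-𝟙 : 𝒟[ + 0 , + 0 ] 𝟙 ≗ (λ _ → + 0)
𝒟-𝟙 zero          = refl
𝒟-𝟙 (suc zero)    = refl
𝒟-𝟙 (suc (suc E)) = cong₂ _+ℤ_ (ℤ.*-zeroʳ (+ 0 +ℤ + 2 *ℤ + suc (suc E))) (ℤ.*-zeroʳ (+ 0 +ℤ - + 2 *ℤ + suc E))

𝒟-leibniz-∏⋆ : ∀ {k} (W : Fin k → Series) (c b : Fin k → ℤ) →
  (λ E → ∑[ i < k ] ∏⋆ (Vector.updateAt W i 𝒟[ c i , b i ]) E) ≗ 𝒟[ ∑.sum c , ∑.sum b ] (∏⋆ W)
𝒟-leibniz-∏⋆ {zero}  W c b E = sym (𝒟-𝟙 E)
𝒟-leibniz-∏⋆ {suc k} W c b E = begin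
  (𝒟[ c₀ , b₀ ] W₀ ⋆ ∏⋆ W′) E +ℤ ∑[ i < k ] (W₀ ⋆ updated i) E
    ≡⟨ cong ((𝒟[ c₀ , b₀ ] W₀ ⋆ ∏⋆ W′) E +ℤ_) (sym (⋆-∑ W₀ updated E)) ⟩
  (𝒟[ c₀ , b₀ ] W₀ ⋆ ∏⋆ W′) E +ℤ (W₀ ⋆ (λ e → ∑[ i < k ] updated i e)) E
    ≡⟨ cong ((𝒟[ c₀ , b₀ ] W₀ ⋆ ∏⋆ W′) E +ℤ_) (⋆-congʳ W₀ (𝒟-leibniz-∏⋆ W′ c′ b′) E) ⟩
  (𝒟[ c₀ , b₀ ] W₀ ⋆ ∏⋆ W′) E +ℤ (W₀ ⋆ 𝒟[ ∑.sum c′ , ∑.sum b′ ] (∏⋆ W′)) E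
    ≡⟨ 𝒟-leibniz c₀ (∑.sum c′) b₀ (∑.sum b′) W₀ (∏⋆ W′) E ⟩
  𝒟[ ∑.sum c , ∑.sum b ] (∏⋆ W) E  ∎
  where
  open ≡-Reasoning
  W₀ = W Fin.zero
  W′ = W ∘ Fin.suc
  c₀ = c Fin.zero
  b₀ = b Fin.zero
  c′ = c ∘ Fin.suc
  b′ = b ∘ Fin.suc
  updated : Fin k → Series
  updated i = ∏⋆ (Vector.updateAt W′ i 𝒟[ c′ i , b′ i ])

-- The block series

[r+1]*nC[r+1]+r*nCr≡n*nCr : ∀ n r → suc r * (n C suc r) + r * (n C r) ≡ n * (n C r)
[r+1]*nC[r+1]+r*nCr≡n*nCr zero    zero    = refl
[r+1]*nC[r+1]+r*nCr≡n*nCr zero    (suc r) = cong₂ _+_ (ℕ.*-zeroʳ (suc (suc r))) (ℕ.*-zeroʳ (suc r))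
[r+1]*nC[r+1]+r*nCr≡n*nCr (suc n) zero    =
  trans (ℕ.+-identityʳ _) (trans (ℕ.*-identityˡ _) (trans (nC1≡n (suc n)) (sym (ℕ.*-identityʳ (suc n)))))
[r+1]*nC[r+1]+r*nCr≡n*nCr (suc n) (suc r) = begin
  suc (suc r) * (suc n C suc (suc r)) + suc r * (suc n C suc r)
    ≡⟨ cong₂ (λ x y → suc (suc r) * x + suc r * y) (sym (pascal n (suc r))) (sym (pascal n r)) ⟩
  suc (suc r) * (C₁ + C₂) + suc r * (C₀ + C₁)
    ≡⟨ regroup₁ r C₀ C₁ C₂ ⟩
  (suc (suc r) * C₂ + suc r * C₁) + (suc (suc r) * C₁ + suc r * C₀)
    ≡⟨ cong (_+ (suc (suc r) * C₁ + suc r * C₀)) ([r+1]*nC[r+1]+r*nCr≡n*nCr n (suc r)) ⟩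
  n * C₁ + (suc (suc r) * C₁ + suc r * C₀)
    ≡⟨ regroup₂ r n C₀ C₁ ⟩
  (suc r * C₁ + r * C₀) + (C₀ + n * C₁ + C₁)
    ≡⟨ cong (_+ (C₀ + n * C₁ + C₁)) ([r+1]*nC[r+1]+r*nCr≡n*nCr n r) ⟩
  n * C₀ + (C₀ + n * C₁ + C₁)
    ≡⟨ regroup₃ n C₀ C₁ ⟩
  suc n * (C₀ + C₁)
    ≡⟨ cong (suc n *_) (pascal n r) ⟩
  suc n * (suc n C suc r)  ∎
  where
  open ≡-Reasoning
  pascal = nCk+nC[k+1]≡[n+1]C[k+1]
  C₀ = n C r
  C₁ = n C suc r
  C₂ = n C suc (suc r)
  regroup₁ : ∀ r C₀ C₁ C₂ → suc (suc r) * (C₁ + C₂) + suc r * (C₀ + C₁)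
                          ≡ (suc (suc r) * C₂ + suc r * C₁) + (suc (suc r) * C₁ + suc r * C₀)
  regroup₁ = ℕ-Solver.solve-∀
  regroup₂ : ∀ r n C₀ C₁ → n * C₁ + (suc (suc r) * C₁ + suc r * C₀)
                         ≡ (suc r * C₁ + r * C₀) + (C₀ + n * C₁ + C₁)
  regroup₂ = ℕ-Solver.solve-∀
  regroup₃ : ∀ n C₀ C₁ → n * C₀ + (C₀ + n * C₁ + C₁) ≡ suc n * (C₀ + C₁)
  regroup₃ = ℕ-Solver.solve-∀

[n+2]C[r+2] : ∀ n r → suc (suc n) C suc (suc r) ≡ n C r + 2 * (n C suc r) + n C suc (suc r)
[n+2]C[r+2] n r = begin
  suc (suc n) C suc (suc r)                               ≡⟨ sym (pascal (suc n) (suc r)) ⟩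
  suc n C suc r + suc n C suc (suc r)                     ≡⟨ cong₂ _+_ (sym (pascal n r)) (sym (pascal n (suc r))) ⟩
  (n C r + n C suc r) + (n C suc r + n C suc (suc r))      ≡⟨ regroup (n C r) (n C suc r) (n C suc (suc r)) ⟩
  n C r + 2 * (n C suc r) + n C suc (suc r)               ∎
  where
  open ≡-Reasoning
  pascal = nCk+nC[k+1]≡[n+1]C[k+1]
  regroup : ∀ a b c → (a + b) + (b + c) ≡ a + 2 * b + c
  regroup = ℕ-Solver.solve-∀

prodℤ-applyUpTo-last : ∀ (F : ℕ → ℤ) (f : ℕ → ℕ) n →
  prodℤ (map F (applyUpTo f (suc n))) ≡ prodℤ (map F (applyUpTo f n)) *ℤ F (f n)
prodℤ-applyUpTo-last F f zero    = trans (ℤ.*-identityʳ (F (f 0))) (sym (ℤ.*-identityˡ (F (f 0))))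
prodℤ-applyUpTo-last F f (suc n) =
  trans (cong (F (f 0) *ℤ_) (prodℤ-applyUpTo-last F (f ∘ suc) n)) (sym (ℤ.*-assoc (F (f 0)) _ _))

+[2n+1] : ∀ n → + (2 * n + 1) ≡ + 2 *ℤ + n +ℤ + 1
+[2n+1] n = trans (ℤ.pos-+ (2 * n) 1) (cong (_+ℤ + 1) (ℤ.pos-* 2 n))

+[2n+2] : ∀ n → + (2 * suc n) ≡ + 2 *ℤ + n +ℤ + 2
+[2n+2] n = begin
  + (2 * suc n)          ≡⟨ cong +_ (ℕ.*-suc 2 n) ⟩
  + (2 + 2 * n)          ≡⟨ ℤ.pos-+ 2 (2 * n) ⟩
  + 2 +ℤ + (2 * n)       ≡⟨ ℤ.+-comm (+ 2) (+ (2 * n)) ⟩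
  + (2 * n) +ℤ + 2       ≡⟨ cong (_+ℤ + 2) (ℤ.pos-* 2 n) ⟩
  + 2 *ℤ + n +ℤ + 2      ∎
  where open ≡-Reasoning

oddProd-∷ʳ : ∀ d s → oddProd d (suc (suc s)) ≡ oddProd d (suc s) *ℤ (+ (2 * d + 1) -ℤ + (2 * suc s))
oddProd-∷ʳ d s = prodℤ-applyUpTo-last (λ i → + (2 * d + 1) -ℤ + (2 * i)) suc s

oddProd-suc : ∀ e s → oddProd (suc e) (suc (suc s)) ≡ + (2 * e + 1) *ℤ oddProd e (suc s)
oddProd-suc e s =
  cong₂ _*ℤ_ (trans (factor e 0) (ℤ.+-identityʳ (+ (2 * e + 1)))) (cong prodℤ (begin
    map F′ (applyUpTo (suc ∘ suc) s)      ≡⟨ cong (map F′) (sym (List.map-applyUpTo suc suc s)) ⟩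
    map F′ (map suc (applyUpTo suc s))    ≡⟨ sym (List.map-∘ (applyUpTo suc s)) ⟩
    map (F′ ∘ suc) (applyUpTo suc s)      ≡⟨ List.map-cong (factor e) (applyUpTo suc s) ⟩
    map F (applyUpTo suc s)               ∎))
  where
  open ≡-Reasoning
  F F′ : ℕ → ℤ
  F  i = + (2 * e + 1) -ℤ + (2 * i)
  F′ i = + (2 * suc e + 1) -ℤ + (2 * i)
  factor : ∀ e i → + (2 * suc e + 1) -ℤ + (2 * suc i) ≡ + (2 * e + 1) -ℤ + (2 * i)
  factor e i = begin
    + (2 * suc e + 1) -ℤ + (2 * suc i)          ≡⟨ cong₂ _-ℤ_ (+[2n+1] (suc e)) (+[2n+2] i) ⟩
    + 2 *ℤ + suc e +ℤ + 1 -ℤ (+ 2 *ℤ + i +ℤ + 2)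
                                                ≡⟨ cong (λ x → + 2 *ℤ x +ℤ + 1 -ℤ (+ 2 *ℤ + i +ℤ + 2)) (ℤ.pos-+ 1 e) ⟩
    + 2 *ℤ (+ 1 +ℤ + e) +ℤ + 1 -ℤ (+ 2 *ℤ + i +ℤ + 2) ≡⟨ cancel (+ e) (+ i) ⟩
    + 2 *ℤ + e +ℤ + 1 -ℤ + 2 *ℤ + i              ≡⟨ sym (cong₂ _-ℤ_ (+[2n+1] e) (ℤ.pos-* 2 i)) ⟩
    + (2 * e + 1) -ℤ + (2 * i)                  ∎
    where
    cancel : ∀ e i → + 2 *ℤ (+ 1 +ℤ e) +ℤ + 1 -ℤ (+ 2 *ℤ i +ℤ + 2) ≡ + 2 *ℤ e +ℤ + 1 -ℤ + 2 *ℤ i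
    cancel = solve-∀

[2e+1]*nC[2e+1]≡[n-2e]*nC[2e] : ∀ n e → + (2 * e + 1) *ℤ + (n C suc (2 * e)) ≡ (+ n -ℤ + (2 * e)) *ℤ + (n C (2 * e))
[2e+1]*nC[2e+1]≡[n-2e]*nC[2e] n e = begin
  + (2 * e + 1) *ℤ + (n C suc (2 * e))          ≡⟨ sym (ℤ.pos-* (2 * e + 1) _) ⟩
  + ((2 * e + 1) * (n C suc (2 * e)))           ≡⟨ cong (λ r → + (r * (n C suc (2 * e)))) (ℕ.+-comm (2 * e) 1) ⟩
  + (suc (2 * e) * (n C suc (2 * e)))           ≡⟨ subtract ([r+1]*nC[r+1]+r*nCr≡n*nCr n (2 * e)) ⟩
  + (n * (n C (2 * e))) -ℤ + (2 * e * (n C (2 * e)))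
    ≡⟨ cong₂ _-ℤ_ (ℤ.pos-* n _) (ℤ.pos-* (2 * e) _) ⟩
  + n *ℤ + (n C (2 * e)) -ℤ + (2 * e) *ℤ + (n C (2 * e))
    ≡⟨ factor (+ n) (+ (2 * e)) (+ (n C (2 * e))) ⟩
  (+ n -ℤ + (2 * e)) *ℤ + (n C (2 * e))         ∎
  where
  open ≡-Reasoning
  cancel : ∀ x y → x ≡ x +ℤ y -ℤ y
  cancel = solve-∀
  factor : ∀ a b c → a *ℤ c -ℤ b *ℤ c ≡ (a -ℤ b) *ℤ c
  factor = solve-∀
  subtract : ∀ {x y z} → x + y ≡ z → + x ≡ + z -ℤ + y
  subtract {x} {y} refl = trans (cancel (+ x) (+ y)) (cong (_-ℤ + y) (sym (ℤ.pos-+ x y)))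

blockSeries : ℕ → ℕ → Series
blockSeries A s d = + ((2 * A + 1) C (2 * d)) *ℤ oddProd d s

blockSeries-suc-coefficient : ∀ A e s c₀ c₂ p₀ p₁ →
  c₂ *ℤ (p₁ *ℤ (+ (2 * suc e + 1) -ℤ + (2 * suc s)))
    +ℤ (+ (2 * e + 1) *ℤ c₀ +ℤ + 2 *ℤ ((+ (2 * A + 1) -ℤ + (2 * e)) *ℤ c₀)) *ℤ p₀
  ≡ (+ 1 -ℤ + (2 * suc s) +ℤ + 2 *ℤ + suc e) *ℤ (c₂ *ℤ p₁) +ℤ (+ (4 * A + 3) +ℤ - + 2 *ℤ + e) *ℤ (c₀ *ℤ p₀)
blockSeries-suc-coefficient A e s c₀ c₂ p₀ p₁ =
  unfoldCasts (trans (+[2n+1] (suc e)) (cong (λ x → + 2 *ℤ x +ℤ + 1) (ℤ.pos-+ 1 e))) (+[2n+2] s) (+[2n+1] e)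
              (+[2n+1] A) (ℤ.pos-* 2 e) (ℤ.pos-+ 1 e) (trans (ℤ.pos-+ (4 * A) 3) (cong (_+ℤ + 3) (ℤ.pos-* 4 A)))
  where
  identity : ∀ a e s c₀ c₂ p₀ p₁ →
    c₂ *ℤ (p₁ *ℤ (+ 2 *ℤ (+ 1 +ℤ e) +ℤ + 1 -ℤ (+ 2 *ℤ s +ℤ + 2)))
      +ℤ ((+ 2 *ℤ e +ℤ + 1) *ℤ c₀ +ℤ + 2 *ℤ ((+ 2 *ℤ a +ℤ + 1 -ℤ + 2 *ℤ e) *ℤ c₀)) *ℤ p₀
    ≡ (+ 1 -ℤ (+ 2 *ℤ s +ℤ + 2) +ℤ + 2 *ℤ (+ 1 +ℤ e)) *ℤ (c₂ *ℤ p₁)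
        +ℤ (+ 4 *ℤ a +ℤ + 3 +ℤ - + 2 *ℤ e) *ℤ (c₀ *ℤ p₀)
  identity = solve-∀
  unfoldCasts : ∀ {x₁ x₂ x₃ x₄ x₅ x₆ x₇} →
    x₁ ≡ + 2 *ℤ (+ 1 +ℤ + e) +ℤ + 1 → x₂ ≡ + 2 *ℤ + s +ℤ + 2 → x₃ ≡ + 2 *ℤ + e +ℤ + 1 →
    x₄ ≡ + 2 *ℤ + A +ℤ + 1 →
    x₅ ≡ + 2 *ℤ + e → x₆ ≡ + 1 +ℤ + e → x₇ ≡ + 4 *ℤ + A +ℤ + 3 →
    c₂ *ℤ (p₁ *ℤ (x₁ -ℤ x₂)) +ℤ (x₃ *ℤ c₀ +ℤ + 2 *ℤ ((x₄ -ℤ x₅) *ℤ c₀)) *ℤ p₀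
      ≡ (+ 1 -ℤ x₂ +ℤ + 2 *ℤ x₆) *ℤ (c₂ *ℤ p₁) +ℤ (x₇ +ℤ - + 2 *ℤ + e) *ℤ (c₀ *ℤ p₀)
  unfoldCasts refl refl refl refl refl refl refl = identity (+ A) (+ e) (+ s) c₀ c₂ p₀ p₁

-- Adding one element of weight 1 to a block of size s + 1 ≥ 1.
blockSeries-suc : ∀ A s →
  blockSeries (suc A) (suc (suc s)) ≗ 𝒟[ + 1 -ℤ + (2 * suc s) , + (4 * A + 3) ] (blockSeries A (suc s))
blockSeries-suc A s zero = begin
  + 1 *ℤ oddProd 0 (suc (suc s))                          ≡⟨ cong (+ 1 *ℤ_) (oddProd-∷ʳ 0 s) ⟩
  + 1 *ℤ (oddProd 0 (suc s) *ℤ (+ 1 -ℤ + (2 * suc s)))   ≡⟨ regroup (oddProd 0 (suc s)) (+ 1 -ℤ + (2 * suc s)) ⟩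
  (+ 1 -ℤ + (2 * suc s) +ℤ + 2 *ℤ + 0) *ℤ (+ 1 *ℤ oddProd 0 (suc s)) +ℤ + 0  ∎
  where
  open ≡-Reasoning
  regroup : ∀ p c → + 1 *ℤ (p *ℤ c) ≡ (c +ℤ + 2 *ℤ + 0) *ℤ (+ 1 *ℤ p) +ℤ + 0
  regroup = solve-∀
blockSeries-suc A s (suc e) = begin
  + ((2 * suc A + 1) C (2 * suc e)) *ℤ oddProd (suc e) (suc (suc s))
    ≡⟨ cong (λ x → + x *ℤ oddProd (suc e) (suc (suc s))) binomial ⟩
  + (C₀ + 2 * C₁ + C₂) *ℤ oddProd (suc e) (suc (suc s))
    ≡⟨ cong (_*ℤ oddProd (suc e) (suc (suc s))) (trans (ℤ.pos-+ (C₀ + 2 * C₁) C₂)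
                                                       (cong (_+ℤ + C₂) (trans (ℤ.pos-+ C₀ (2 * C₁)) (cong (+ C₀ +ℤ_) (ℤ.pos-* 2 C₁))))) ⟩
  (+ C₀ +ℤ + 2 *ℤ + C₁ +ℤ + C₂) *ℤ oddProd (suc e) (suc (suc s))
    ≡⟨ split (+ C₀) (+ C₁) (+ C₂) (oddProd (suc e) (suc (suc s))) ⟩
  + C₂ *ℤ oddProd (suc e) (suc (suc s)) +ℤ (+ C₀ +ℤ + 2 *ℤ + C₁) *ℤ oddProd (suc e) (suc (suc s))
    ≡⟨ cong₂ (λ x y → + C₂ *ℤ x +ℤ (+ C₀ +ℤ + 2 *ℤ + C₁) *ℤ y) (oddProd-∷ʳ (suc e) s) (oddProd-suc e s) ⟩
  + C₂ *ℤ (P₁ *ℤ (+ (2 * suc e + 1) -ℤ + (2 * suc s))) +ℤ (+ C₀ +ℤ + 2 *ℤ + C₁) *ℤ (+ (2 * e + 1) *ℤ P₀)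
    ≡⟨ cong (+ C₂ *ℤ (P₁ *ℤ (+ (2 * suc e + 1) -ℤ + (2 * suc s))) +ℤ_) absorbed ⟩
  + C₂ *ℤ (P₁ *ℤ (+ (2 * suc e + 1) -ℤ + (2 * suc s)))
    +ℤ (+ (2 * e + 1) *ℤ + C₀ +ℤ + 2 *ℤ ((+ n -ℤ + (2 * e)) *ℤ + C₀)) *ℤ P₀
    ≡⟨ blockSeries-suc-coefficient A e s (+ C₀) (+ C₂) P₀ P₁ ⟩
  𝒟[ + 1 -ℤ + (2 * suc s) , + (4 * A + 3) ] (blockSeries A (suc s)) (suc e)  ∎
  where
  open ≡-Reasoning
  n  = 2 * A + 1
  C₀ = n C (2 * e)
  C₁ = n C suc (2 * e)
  C₂ = n C (2 * suc e)
  P₀ = oddProd e (suc s)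
  P₁ = oddProd (suc e) (suc s)
  2[x+1] : ∀ x → 2 * suc x ≡ suc (suc (2 * x))
  2[x+1] = ℕ-Solver.solve-∀
  binomial : (2 * suc A + 1) C (2 * suc e) ≡ C₀ + 2 * C₁ + C₂
  binomial = begin
    (2 * suc A + 1) C (2 * suc e)                   ≡⟨ cong₂ _C_ (cong (_+ 1) (2[x+1] A)) (2[x+1] e) ⟩
    suc (suc n) C suc (suc (2 * e))                 ≡⟨ [n+2]C[r+2] n (2 * e) ⟩
    C₀ + 2 * C₁ + n C suc (suc (2 * e))             ≡⟨ cong (λ r → C₀ + 2 * C₁ + n C r) (sym (2[x+1] e)) ⟩
    C₀ + 2 * C₁ + C₂                                ∎
  split : ∀ c₀ c₁ c₂ p → (c₀ +ℤ + 2 *ℤ c₁ +ℤ c₂) *ℤ p ≡ c₂ *ℤ p +ℤ (c₀ +ℤ + 2 *ℤ c₁) *ℤ p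
  split = solve-∀
  distribute : ∀ c₀ c₁ t p → (c₀ +ℤ + 2 *ℤ c₁) *ℤ (t *ℤ p) ≡ (t *ℤ c₀ +ℤ + 2 *ℤ (t *ℤ c₁)) *ℤ p
  distribute = solve-∀
  absorbed : (+ C₀ +ℤ + 2 *ℤ + C₁) *ℤ (+ (2 * e + 1) *ℤ P₀)
           ≡ (+ (2 * e + 1) *ℤ + C₀ +ℤ + 2 *ℤ ((+ n -ℤ + (2 * e)) *ℤ + C₀)) *ℤ P₀
  absorbed = trans (distribute (+ C₀) (+ C₁) (+ (2 * e + 1)) P₀)
    (cong (λ x → (+ (2 * e + 1) *ℤ + C₀ +ℤ + 2 *ℤ x) *ℤ P₀) ([2e+1]*nC[2e+1]≡[n-2e]*nC[2e] n e))

-- A new singleton block {n + 1} with a_{n+1} = 1 has series 1 + 3x.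
blockSeries-1-1-⋆ : ∀ Z E → (blockSeries 1 1 ⋆ Z) (suc E) ≡ Z (suc E) +ℤ + 3 *ℤ Z E
blockSeries-1-1-⋆ Z E = cong₂ _+ℤ_ (ℤ.*-identityˡ (Z (suc E))) (higher E)
  where
  vanishes : ∀ d → blockSeries 1 1 (suc (suc d)) ≡ + 0
  vanishes d = cong (λ x → + x *ℤ + 1) (k>n⇒nCk≡0 (subst (3 ℕ.<_) (4+2d d) (s≤s (s≤s (s≤s (s≤s z≤n))))))
    where
    4+2d : ∀ d → 4 + 2 * d ≡ 2 * suc (suc d)
    4+2d = ℕ-Solver.solve-∀
  higher : ∀ E → antidiagonal (λ d e → blockSeries 1 1 (suc d) *ℤ Z e) E ≡ + 3 *ℤ Z E
  higher zero    = refl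
  higher (suc E) = trans (cong (+ 3 *ℤ Z (suc E) +ℤ_)
                               (antidiagonal-zero (λ d e → cong (_*ℤ Z e) (vanishes d)) E))
                         (ℤ.+-identityʳ _)

sumℤ-applyUpTo-antidiagonal : ∀ (F : ℕ → ℕ → ℤ) E →
  sumℤ (applyUpTo (λ d → F d (E ∸ d)) (suc E)) ≡ antidiagonal F E
sumℤ-applyUpTo-antidiagonal F zero    = ℤ.+-identityʳ _
sumℤ-applyUpTo-antidiagonal F (suc E) = cong (F 0 (suc E) +ℤ_) (sumℤ-applyUpTo-antidiagonal (λ d → F (suc d)) E)

coefficientProduct : ∀ {k} → (Fin k → Series) → Vec ℕ k → ℤ
coefficientProduct {k} W ds = prodℤ (map (λ j → W j (Vec.lookup ds j)) (allFin k))

coefficientProduct-∷ : ∀ {k} (W : Fin (suc k) → Series) d ds →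
  coefficientProduct W (d ∷ ds) ≡ W Fin.zero d *ℤ coefficientProduct (W ∘ Fin.suc) ds
coefficientProduct-∷ {k} W d ds =
  trans (cong prodℤ (List.map-tabulate id F))
        (cong (F Fin.zero *ℤ_) (sym (cong prodℤ (List.map-tabulate id (F ∘ Fin.suc)))))
  where
  F : Fin (suc k) → ℤ
  F j = W j (Vec.lookup (d ∷ ds) j)

sumOf-compositions : ∀ k E (W : Fin k → Series) → sumOf (compositions k E) (coefficientProduct W) ≡ ∏⋆ W E
sumOf-compositions zero    zero    W = refl
sumOf-compositions zero    (suc E) W = refl
sumOf-compositions (suc k) E       W = begin
  sumOf (compositions (suc k) E) (coefficientProduct W)
    ≡⟨ sumOf-concatMap (List.upTo (suc E)) (λ d → map (d ∷_) (compositions k (E ∸ d))) _ ⟩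
  sumOf (List.upTo (suc E)) (λ d → sumOf (map (d ∷_) (compositions k (E ∸ d))) (coefficientProduct W))
    ≡⟨ sumOf-cong (List.upTo (suc E)) first ⟩
  sumOf (List.upTo (suc E)) (λ d → W Fin.zero d *ℤ ∏⋆ (W ∘ Fin.suc) (E ∸ d))
    ≡⟨ cong sumℤ (List.map-applyUpTo id (λ d → W Fin.zero d *ℤ ∏⋆ (W ∘ Fin.suc) (E ∸ d)) (suc E)) ⟩
  sumℤ (applyUpTo (λ d → W Fin.zero d *ℤ ∏⋆ (W ∘ Fin.suc) (E ∸ d)) (suc E))
    ≡⟨ sumℤ-applyUpTo-antidiagonal (λ d e → W Fin.zero d *ℤ ∏⋆ (W ∘ Fin.suc) e) E ⟩
  ∏⋆ W E  ∎
  where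
  open ≡-Reasoning
  first : ∀ d → sumOf (map (d ∷_) (compositions k (E ∸ d))) (coefficientProduct W)
              ≡ W Fin.zero d *ℤ ∏⋆ (W ∘ Fin.suc) (E ∸ d)
  first d = begin
    sumOf (map (d ∷_) (compositions k (E ∸ d))) (coefficientProduct W)
      ≡⟨ sumOf-map (compositions k (E ∸ d)) (d ∷_) _ ⟩
    sumOf (compositions k (E ∸ d)) (coefficientProduct W ∘ (d ∷_))
      ≡⟨ sumOf-cong (compositions k (E ∸ d)) (coefficientProduct-∷ W d) ⟩
    sumOf (compositions k (E ∸ d)) (λ ds → W Fin.zero d *ℤ coefficientProduct (W ∘ Fin.suc) ds)
      ≡⟨ sumOf-*ˡ (compositions k (E ∸ d)) (W Fin.zero d) _ ⟩
    W Fin.zero d *ℤ sumOf (compositions k (E ∸ d)) (coefficientProduct (W ∘ Fin.suc))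
      ≡⟨ cong (W Fin.zero d *ℤ_) (sumOf-compositions k (E ∸ d) (W ∘ Fin.suc)) ⟩
    W Fin.zero d *ℤ ∏⋆ (W ∘ Fin.suc) (E ∸ d)  ∎

blockSeriesOf : ∀ {k m} → Vec ℕ m → Vec (Fin k) m → Fin k → Series
blockSeriesOf a f j = blockSeries (blockSum f a j) (blockSize f j)

partitionSum : ∀ {m} → Vec ℕ m → ℕ → Series
partitionSum {m} a k E = sumOf (allMaps k m) (λ f → indicator (allBlocksNonempty f) *ℤ ∏⋆ (blockSeriesOf a f) E)

partitionSum-more-blocks : ∀ {n} (a : Vec ℕ n) E → partitionSum a (suc n) E ≡ + 0
partitionSum-more-blocks {n} a E = sumOf-zero (allMaps (suc n) n) vanishes
  where
  vanishes : ∀ f → indicator (allBlocksNonempty f) *ℤ ∏⋆ (blockSeriesOf a f) E ≡ + 0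
  vanishes f with allBlocksNonempty f in all
  ... | true  = ⊥-elim (ℕ.<-irrefl refl (allBlocksNonempty⇒≤ f all))
  ... | false = refl

innerSum≡partitionSum : ∀ g k m (a : Vec ℕ m) → innerSum g k m a ≡ partitionSum a k (g ∸ 2 + m)
innerSum≡partitionSum g k m a = begin
  sumℤ (concatMap (λ f → map (term a f) (compositions k E)) (orderedPartitions k m))
    ≡⟨ sumℤ-concatMap (orderedPartitions k m) _ ⟩
  sumOf (orderedPartitions k m) (λ f → sumOf (compositions k E) (term a f))
    ≡⟨ sumOf-filterᵇ allBlocksNonempty (allMaps k m) _ ⟩
  sumOf (allMaps k m) (λ f → indicator (allBlocksNonempty f) *ℤ sumOf (compositions k E) (term a f))
    ≡⟨ sumOf-cong (allMaps k m) (λ f → cong (indicator (allBlocksNonempty f) *ℤ_)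
                                           (sumOf-compositions k E (blockSeriesOf a f))) ⟩
  partitionSum a k E  ∎
  where
  open ≡-Reasoning
  E = g ∸ 2 + m

-- Appending a part equal to 1

module AppendOne {n : ℕ} (a : Vec ℕ n) where

  leading : ℕ → ℤ
  leading k = + k -ℤ + 2 *ℤ + n

  trailing : ℕ → ℤ
  trailing k = + 4 *ℤ + sum a +ℤ + 3 *ℤ + k

  ∑-leading : ∀ {k} (f : Vec (Fin k) n) → ∑[ j < k ] (+ 1 -ℤ + (2 * blockSize f j)) ≡ leading k
  ∑-leading {k} f = begin
    ∑[ j < k ] (+ 1 -ℤ + (2 * blockSize f j))
      ≡⟨ ∑.sum-cong-≗ (λ j → cong (λ x → + 1 -ℤ x) (ℤ.pos-* 2 (blockSize f j))) ⟩
    ∑[ j < k ] (+ 1 +ℤ - (+ 2 *ℤ + blockSize f j))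
      ≡⟨ ∑.∑-distrib-+ (λ _ → + 1) (λ j → - (+ 2 *ℤ + blockSize f j)) ⟩
    ∑[ j < k ] (+ 1) +ℤ ∑[ j < k ] (- (+ 2 *ℤ + blockSize f j))
      ≡⟨ cong₂ _+ℤ_ (trans (∑-const k (+ 1)) (ℤ.*-identityʳ (+ k)))
                    (∑.sum-cong-≗ (λ j → ℤ.neg-distribˡ-* (+ 2) (+ blockSize f j))) ⟩
    + k +ℤ ∑[ j < k ] (- + 2 *ℤ + blockSize f j)
      ≡⟨ cong (+ k +ℤ_) (sym (∑.*-distribˡ-sum (- + 2) (λ j → + blockSize f j))) ⟩
    + k +ℤ - + 2 *ℤ ∑[ j < k ] (+ blockSize f j)
      ≡⟨ cong (λ x → + k +ℤ - + 2 *ℤ x) (trans (sym (pos-∑ (blockSize f))) (cong +_ (∑-blockSize f))) ⟩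
    + k +ℤ - + 2 *ℤ + n
      ≡⟨ cong (+ k +ℤ_) (sym (ℤ.neg-distribˡ-* (+ 2) (+ n))) ⟩
    leading k  ∎
    where open ≡-Reasoning

  ∑-trailing : ∀ {k} (f : Vec (Fin k) n) → ∑[ j < k ] (+ (4 * blockSum f a j + 3)) ≡ trailing k
  ∑-trailing {k} f = begin
    ∑[ j < k ] (+ (4 * blockSum f a j + 3))
      ≡⟨ ∑.sum-cong-≗ (λ j → trans (ℤ.pos-+ (4 * blockSum f a j) 3) (cong (_+ℤ + 3) (ℤ.pos-* 4 (blockSum f a j)))) ⟩
    ∑[ j < k ] (+ 4 *ℤ + blockSum f a j +ℤ + 3)
      ≡⟨ ∑.∑-distrib-+ (λ j → + 4 *ℤ + blockSum f a j) (λ _ → + 3) ⟩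
    ∑[ j < k ] (+ 4 *ℤ + blockSum f a j) +ℤ ∑[ j < k ] (+ 3)
      ≡⟨ cong₂ _+ℤ_ (sym (∑.*-distribˡ-sum (+ 4) (λ j → + blockSum f a j)))
                    (trans (∑-const k (+ 3)) (ℤ.*-comm (+ k) (+ 3))) ⟩
    + 4 *ℤ ∑[ j < k ] (+ blockSum f a j) +ℤ + 3 *ℤ + k
      ≡⟨ cong (λ x → + 4 *ℤ x +ℤ + 3 *ℤ + k) (trans (sym (pos-∑ (blockSum f a))) (cong +_ (∑-blockSum f a))) ⟩
    trailing k  ∎
    where open ≡-Reasoning

  grow : ∀ {k} → Vec (Fin k) n → Fin k → Series → Series
  grow f i = 𝒟[ + 1 -ℤ + (2 * blockSize f i) , + (4 * blockSum f a i + 3) ]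

  blockSeriesOf-∷ʳ : ∀ {k} (f : Vec (Fin k) n) i → 1 ≤ blockSize f i → ∀ j →
    blockSeriesOf (a ∷ʳ 1) (f ∷ʳ i) j ≗ Vector.updateAt (blockSeriesOf a f) i (grow f i) j
  blockSeriesOf-∷ʳ f i i-nonempty j e rewrite blockSum-∷ʳ f a i 1 j | blockSize-∷ʳ f i j with i Fin.≟ j
  ... | yes refl = trans (grown (blockSum f a i) (blockSize f i) i-nonempty e)
                         (sym (cong (λ h → h e) (VectorProperties.updateAt-updates i (blockSeriesOf a f))))
    where
    grown : ∀ A s → 1 ≤ s → blockSeries (A + 1) (s + 1) ≗ 𝒟[ + 1 -ℤ + (2 * s) , + (4 * A + 3) ] (blockSeries A s)
    grown A (suc s) _ rewrite ℕ.+-comm A 1 | ℕ.+-comm s 1 = blockSeries-suc A s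
  ... | no i≢j = trans (cong₂ (λ A s → blockSeries A s e) (ℕ.+-identityʳ (blockSum f a j)) (ℕ.+-identityʳ (blockSize f j)))
                       (sym (cong (λ h → h e) (VectorProperties.updateAt-minimal j i (blockSeriesOf a f) (i≢j ∘ sym))))

  -- The element n + 1 joins one of the k blocks of f.
  ∑-join : ∀ {k} (f : Vec (Fin k) n) → allBlocksNonempty f ≡ true → ∀ E →
    ∑[ i < k ] ∏⋆ (blockSeriesOf (a ∷ʳ 1) (f ∷ʳ i)) (suc E)
      ≡ 𝒟[ leading k , trailing k ] (∏⋆ (blockSeriesOf a f)) (suc E)
  ∑-join {k} f all E = begin
    ∑[ i < k ] ∏⋆ (blockSeriesOf (a ∷ʳ 1) (f ∷ʳ i)) (suc E)
      ≡⟨ ∑.sum-cong-≗ (λ i → ∏⋆-cong (blockSeriesOf-∷ʳ f i (allBlocksNonempty⇒nonempty f all i)) (suc E)) ⟩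
    ∑[ i < k ] ∏⋆ (Vector.updateAt (blockSeriesOf a f) i (grow f i)) (suc E)
      ≡⟨ 𝒟-leibniz-∏⋆ (blockSeriesOf a f) (λ j → + 1 -ℤ + (2 * blockSize f j))
                                          (λ j → + (4 * blockSum f a j + 3)) (suc E) ⟩
    𝒟[ ∑[ j < k ] (+ 1 -ℤ + (2 * blockSize f j)) , ∑[ j < k ] (+ (4 * blockSum f a j + 3)) ] (∏⋆ (blockSeriesOf a f)) (suc E)
      ≡⟨ cong₂ (λ c b → 𝒟[ c , b ] (∏⋆ (blockSeriesOf a f)) (suc E)) (∑-leading f) (∑-trailing f) ⟩
    𝒟[ leading k , trailing k ] (∏⋆ (blockSeriesOf a f)) (suc E)  ∎
    where open ≡-Reasoning

  -- The element n + 1 forms a new singleton block i; the other blocks are those of h.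
  singleton-∏⋆ : ∀ {K} (h : Vec (Fin K) n) (i : Fin (suc K)) E →
    ∏⋆ (blockSeriesOf (a ∷ʳ 1) (insert h i)) (suc E)
      ≡ ∏⋆ (blockSeriesOf a h) (suc E) +ℤ + 3 *ℤ ∏⋆ (blockSeriesOf a h) E
  singleton-∏⋆ h i E = begin
    ∏⋆ W (suc E)                                           ≡⟨ ∏⋆-punchIn i W (suc E) ⟩
    (W i ⋆ ∏⋆ (W ∘ punchIn i)) (suc E)                     ≡⟨ ⋆-cong new-block (∏⋆-cong old-blocks) (suc E) ⟩
    (blockSeries 1 1 ⋆ ∏⋆ (blockSeriesOf a h)) (suc E)     ≡⟨ blockSeries-1-1-⋆ (∏⋆ (blockSeriesOf a h)) E ⟩
    ∏⋆ (blockSeriesOf a h) (suc E) +ℤ + 3 *ℤ ∏⋆ (blockSeriesOf a h) E  ∎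
    where
    open ≡-Reasoning
    W = blockSeriesOf (a ∷ʳ 1) (insert h i)
    new-block : W i ≗ blockSeries 1 1
    new-block e = cong₂ (λ A s → blockSeries A s e) (blockSum-insert-hole h a i 1) (blockSize-insert-hole h i)
    old-blocks : ∀ y → W (punchIn i y) ≗ blockSeriesOf a h y
    old-blocks y e = cong₂ (λ A s → blockSeries A s e) (blockSum-insert h a i 1 y) (blockSize-insert h i y)

  indicator-∑-join : ∀ {k} (f : Vec (Fin k) n) E →
    indicator (allBlocksNonempty f) *ℤ ∑[ i < k ] ∏⋆ (blockSeriesOf (a ∷ʳ 1) (f ∷ʳ i)) (suc E)
      ≡ 𝒟[ leading k , trailing k ] (λ e → indicator (allBlocksNonempty f) *ℤ ∏⋆ (blockSeriesOf a f) e) (suc E)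
  indicator-∑-join {k} f E with allBlocksNonempty f in all
  ... | true  = trans (ℤ.*-identityˡ _)
                      (trans (∑-join f all E)
                             (𝒟-cong {leading k} {trailing k} (λ e → sym (ℤ.*-identityˡ (∏⋆ (blockSeriesOf a f) e))) (suc E)))
  ... | false = sym (cong₂ _+ℤ_ (ℤ.*-zeroʳ (leading k +ℤ + 2 *ℤ + suc E)) (ℤ.*-zeroʳ (trailing k +ℤ - + 2 *ℤ + E)))

  indicator-singleton : ∀ {K} (h : Vec (Fin K) n) (i : Fin (suc K)) E →
    indicator (allBlocksNonempty (insert h i)) *ℤ ∏⋆ (blockSeriesOf (a ∷ʳ 1) (insert h i)) (suc E)
      ≡ indicator (allBlocksNonempty h) *ℤ ∏⋆ (blockSeriesOf a h) (suc E)
          +ℤ + 3 *ℤ (indicator (allBlocksNonempty h) *ℤ ∏⋆ (blockSeriesOf a h) E)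
  indicator-singleton h i E = begin
    indicator (allBlocksNonempty (insert h i)) *ℤ ∏⋆ (blockSeriesOf (a ∷ʳ 1) (insert h i)) (suc E)
      ≡⟨ cong₂ _*ℤ_ (cong indicator (allBlocksNonempty-insert h i)) (singleton-∏⋆ h i E) ⟩
    χ *ℤ (∏⋆ (blockSeriesOf a h) (suc E) +ℤ + 3 *ℤ ∏⋆ (blockSeriesOf a h) E)
      ≡⟨ distribute χ (∏⋆ (blockSeriesOf a h) (suc E)) (∏⋆ (blockSeriesOf a h) E) ⟩
    χ *ℤ ∏⋆ (blockSeriesOf a h) (suc E) +ℤ + 3 *ℤ (χ *ℤ ∏⋆ (blockSeriesOf a h) E)  ∎
    where
    open ≡-Reasoning
    χ = indicator (allBlocksNonempty h)
    distribute : ∀ χ x y → χ *ℤ (x +ℤ + 3 *ℤ y) ≡ χ *ℤ x +ℤ + 3 *ℤ (χ *ℤ y)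
    distribute = solve-∀

  partitionSum-∷ʳ : ∀ K E →
    partitionSum (a ∷ʳ 1) (suc K) (suc E)
      ≡ 𝒟[ leading (suc K) , trailing (suc K) ] (partitionSum a (suc K)) (suc E)
          +ℤ + suc K *ℤ (partitionSum a K (suc E) +ℤ + 3 *ℤ partitionSum a K E)
  partitionSum-∷ʳ K E = begin
    partitionSum (a ∷ʳ 1) k (suc E)
      ≡⟨ sumOf-allMaps-∷ʳ k n (λ f′ → χ f′ *ℤ R′ f′) ⟩
    sumOf (allMaps k n) (λ f → ∑[ i < k ] (χ (f ∷ʳ i) *ℤ R f i))
      ≡⟨ sumOf-cong (allMaps k n) (λ f → ∑.sum-cong-≗ (λ i → split f i)) ⟩
    sumOf (allMaps k n) (λ f → ∑[ i < k ] (χ f *ℤ R f i +ℤ missing f i *ℤ (χ (f ∷ʳ i) *ℤ R f i)))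
      ≡⟨ sumOf-cong (allMaps k n) (λ f → ∑.∑-distrib-+ (λ i → χ f *ℤ R f i)
                                                         (λ i → missing f i *ℤ (χ (f ∷ʳ i) *ℤ R f i))) ⟩
    sumOf (allMaps k n) (λ f → ∑[ i < k ] (χ f *ℤ R f i) +ℤ ∑[ i < k ] (missing f i *ℤ (χ (f ∷ʳ i) *ℤ R f i)))
      ≡⟨ sumOf-+ (allMaps k n) _ _ ⟩
    sumOf (allMaps k n) (λ f → ∑[ i < k ] (χ f *ℤ R f i))
      +ℤ sumOf (allMaps k n) (λ f → ∑[ i < k ] (missing f i *ℤ (χ (f ∷ʳ i) *ℤ R f i)))
      ≡⟨ cong₂ _+ℤ_ joined created ⟩
    𝒟[ leading k , trailing k ] (partitionSum a k) (suc E)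
      +ℤ + k *ℤ (partitionSum a K (suc E) +ℤ + 3 *ℤ partitionSum a K E)  ∎
    where
    open ≡-Reasoning
    k = suc K
    χ : ∀ {k m} → Vec (Fin k) m → ℤ
    χ f = indicator (allBlocksNonempty f)
    Q : Vec (Fin K) n → Series
    Q h e = χ h *ℤ ∏⋆ (blockSeriesOf a h) e
    missing : Vec (Fin k) n → Fin k → ℤ
    missing f i = indicator (blockSize f i ℕ.≡ᵇ 0)
    R′ : Vec (Fin k) (suc n) → ℤ
    R′ f′ = ∏⋆ (blockSeriesOf (a ∷ʳ 1) f′) (suc E)
    R : Vec (Fin k) n → Fin k → ℤ
    R f i = R′ (f ∷ʳ i)
    factor : ∀ x y z r → (x +ℤ y *ℤ z) *ℤ r ≡ x *ℤ r +ℤ y *ℤ (z *ℤ r)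
    factor = solve-∀
    split : ∀ f i → χ (f ∷ʳ i) *ℤ R f i ≡ χ f *ℤ R f i +ℤ missing f i *ℤ (χ (f ∷ʳ i) *ℤ R f i)
    split f i = trans (cong (_*ℤ R f i) (indicator-allBlocksNonempty-∷ʳ f i)) (factor (χ f) (missing f i) (χ (f ∷ʳ i)) (R f i))
    joined : sumOf (allMaps k n) (λ f → ∑[ i < k ] (χ f *ℤ R f i)) ≡ 𝒟[ leading k , trailing k ] (partitionSum a k) (suc E)
    joined = begin
      sumOf (allMaps k n) (λ f → ∑[ i < k ] (χ f *ℤ R f i))
        ≡⟨ sumOf-cong (allMaps k n) (λ f → sym (∑.*-distribˡ-sum (χ f) (R f))) ⟩
      sumOf (allMaps k n) (λ f → χ f *ℤ ∑[ i < k ] R f i)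
        ≡⟨ sumOf-cong (allMaps k n) (λ f → indicator-∑-join f E) ⟩
      sumOf (allMaps k n) (λ f → 𝒟[ leading k , trailing k ] (λ e → χ f *ℤ ∏⋆ (blockSeriesOf a f) e) (suc E))
        ≡⟨ sumOf-𝒟 (allMaps k n) (leading k) (trailing k) (λ f e → χ f *ℤ ∏⋆ (blockSeriesOf a f) e) E ⟩
      𝒟[ leading k , trailing k ] (partitionSum a k) (suc E)  ∎
    created : sumOf (allMaps k n) (λ f → ∑[ i < k ] (missing f i *ℤ (χ (f ∷ʳ i) *ℤ R f i)))
            ≡ + k *ℤ (partitionSum a K (suc E) +ℤ + 3 *ℤ partitionSum a K E)
    created = begin
      sumOf (allMaps k n) (λ f → ∑[ i < k ] (missing f i *ℤ (χ (f ∷ʳ i) *ℤ R f i)))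
        ≡⟨ sumOf-∑ (allMaps k n) (λ f i → missing f i *ℤ (χ (f ∷ʳ i) *ℤ R f i)) ⟩
      ∑[ i < k ] sumOf (allMaps k n) (λ f → missing f i *ℤ (χ (f ∷ʳ i) *ℤ R f i))
        ≡⟨ ∑.sum-cong-≗ (λ i → sumOf-allMaps-hole K n i (λ f → χ (f ∷ʳ i) *ℤ R f i)) ⟩
      ∑[ i < k ] sumOf (allMaps K n) (λ h → χ (insert h i) *ℤ R (Vec.map (punchIn i) h) i)
        ≡⟨ ∑.sum-cong-≗ (λ i → sumOf-cong (allMaps K n) (λ h → indicator-singleton h i E)) ⟩
      ∑[ i < k ] sumOf (allMaps K n) (λ h → Q h (suc E) +ℤ + 3 *ℤ Q h E)
        ≡⟨ ∑.sum-cong-≗ {k} (λ i → trans (sumOf-+ (allMaps K n) _ _)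
                                         (cong (partitionSum a K (suc E) +ℤ_) (sumOf-*ˡ (allMaps K n) (+ 3) (λ h → Q h E)))) ⟩
      ∑[ i < k ] (partitionSum a K (suc E) +ℤ + 3 *ℤ partitionSum a K E)
        ≡⟨ ∑-const k _ ⟩
      + k *ℤ (partitionSum a K (suc E) +ℤ + 3 *ℤ partitionSum a K E)  ∎

ι : ℤ → ℚ
ι x = x / 1

ι-+ : ∀ x y → ι x ℚ.+ ι y ≡ ι (x +ℤ y)
ι-+ x y = trans (sym (ℚ.fromℚᵘ-toℚᵘ (ι x ℚ.+ ι y))) (ℚ.fromℚᵘ-cong equivalent)
  where
  regroup : ∀ x y → (x *ℤ + 1 +ℤ y *ℤ + 1) *ℤ + 1 ≡ (x +ℤ y) *ℤ + 1
  regroup = solve-∀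
  equivalent : ℚ.toℚᵘ (ι x ℚ.+ ι y) ℚᵘ.≃ ℚᵘ.mkℚᵘ (x +ℤ y) 0
  equivalent = ℚᵘ.≃-trans (ℚ.toℚᵘ-homo-+ (ι x) (ι y))
    (ℚᵘ.≃-trans (ℚᵘ.+-cong (ℚ.toℚᵘ-fromℚᵘ (ℚᵘ.mkℚᵘ x 0)) (ℚ.toℚᵘ-fromℚᵘ (ℚᵘ.mkℚᵘ y 0)))
                (ℚᵘ.*≡* (regroup x y)))

ι-* : ∀ x y → ι x ℚ.* ι y ≡ ι (x *ℤ y)
ι-* x y = trans (sym (ℚ.fromℚᵘ-toℚᵘ (ι x ℚ.* ι y))) (ℚ.fromℚᵘ-cong equivalent)
  where
  equivalent : ℚ.toℚᵘ (ι x ℚ.* ι y) ℚᵘ.≃ ℚᵘ.mkℚᵘ (x *ℤ y) 0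
  equivalent = ℚᵘ.≃-trans (ℚ.toℚᵘ-homo-* (ι x) (ι y))
    (ℚᵘ.≃-trans (ℚᵘ.*-cong (ℚ.toℚᵘ-fromℚᵘ (ℚᵘ.mkℚᵘ x 0)) (ℚ.toℚᵘ-fromℚᵘ (ℚᵘ.mkℚᵘ y 0)))
                (ℚᵘ.*≡* refl))

/-exact : ∀ (x q : ℤ) (d : ℕ) .{{_ : ℕ.NonZero d}} → x ≡ q *ℤ + d → x / d ≡ ι q
/-exact x q (suc d) x≡qd =
  ℚ.fromℚᵘ-cong {ℚᵘ.mkℚᵘ x d} {ℚᵘ.mkℚᵘ q 0} (ℚᵘ.*≡* (trans (ℤ.*-identityʳ x) x≡qd))

sumℚ-ι : ∀ {A : Set} (xs : List A) (F : A → ℤ) → sumℚ (map (ι ∘ F) xs) ≡ ι (sumOf xs F)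
sumℚ-ι []       F = refl
sumℚ-ι (x ∷ xs) F = trans (cong (ι (F x) ℚ.+_) (sumℚ-ι xs F)) (ι-+ (F x) (sumOf xs F))

k!∣[N+k]! : ∀ N k → k ! ∣ (N + k) !
k!∣[N+k]! zero    k = ∣-refl
k!∣[N+k]! (suc N) k = ∣n⇒∣m*n (suc (N + k)) (k!∣[N+k]! N k)

factorialRatio : ℕ → ℕ → ℕ
factorialRatio N k = ((N + k) ! ℕ./ k !) {{k !≢0}}

factorialRatio-*-! : ∀ N k → factorialRatio N k * k ! ≡ (N + k) !
factorialRatio-*-! N k = m/n*n≡m {{k !≢0}} (k!∣[N+k]! N k)

factorialRatio-suc : ∀ N k → factorialRatio N (suc k) * suc k ≡ (N + suc k) * factorialRatio N k
factorialRatio-suc N k = ℕ.*-cancelʳ-≡ _ _ (k !) {{k !≢0}} (begin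
  factorialRatio N (suc k) * suc k * k !        ≡⟨ ℕ.*-assoc (factorialRatio N (suc k)) (suc k) (k !) ⟩
  factorialRatio N (suc k) * suc k !            ≡⟨ factorialRatio-*-! N (suc k) ⟩
  (N + suc k) !                                 ≡⟨ cong _! (ℕ.+-suc N k) ⟩
  suc (N + k) * (N + k) !                       ≡⟨ cong (_* (N + k) !) (sym (ℕ.+-suc N k)) ⟩
  (N + suc k) * (N + k) !                       ≡⟨ cong ((N + suc k) *_) (sym (factorialRatio-*-! N k)) ⟩
  (N + suc k) * (factorialRatio N k * k !)      ≡⟨ sym (ℕ.*-assoc (N + suc k) (factorialRatio N k) (k !)) ⟩
  (N + suc k) * factorialRatio N k * k !        ∎)
  where open ≡-Reasoning

coeffℤ : ℕ → ℕ → ℤ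
coeffℤ N k = signℤ k *ℤ + factorialRatio N k

coeffℤ-suc : ∀ N k → coeffℤ N (suc k) *ℤ + suc k ≡ - + (N + suc k) *ℤ coeffℤ N k
coeffℤ-suc N k = begin
  - signℤ k *ℤ + factorialRatio N (suc k) *ℤ + suc k      ≡⟨ regroup₁ (signℤ k) (+ factorialRatio N (suc k)) (+ suc k) ⟩
  - signℤ k *ℤ (+ factorialRatio N (suc k) *ℤ + suc k)    ≡⟨ cong (λ x → - signℤ k *ℤ x) casted ⟩
  - signℤ k *ℤ (+ (N + suc k) *ℤ + factorialRatio N k)    ≡⟨ regroup₂ (signℤ k) (+ (N + suc k)) (+ factorialRatio N k) ⟩
  - + (N + suc k) *ℤ coeffℤ N k                      ∎
  where
  open ≡-Reasoning
  regroup₁ : ∀ s r t → - s *ℤ r *ℤ t ≡ - s *ℤ (r *ℤ t)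
  regroup₁ = solve-∀
  regroup₂ : ∀ s m r → - s *ℤ (m *ℤ r) ≡ - m *ℤ (s *ℤ r)
  regroup₂ = solve-∀
  casted : + factorialRatio N (suc k) *ℤ + suc k ≡ + (N + suc k) *ℤ + factorialRatio N k
  casted = trans (sym (ℤ.pos-* (factorialRatio N (suc k)) (suc k)))
                 (trans (cong +_ (factorialRatio-suc N k)) (ℤ.pos-* (N + suc k) (factorialRatio N k)))

coeff≡ι-coeffℤ : ∀ g k → coeff g k ≡ ι (coeffℤ (2 * g ∸ 3) k)
coeff≡ι-coeffℤ g k = /-exact _ (coeffℤ N k) (k !) {{k !≢0}} (begin
  signℤ k *ℤ + ((N + k) !)                               ≡⟨ cong (λ x → signℤ k *ℤ + x) (sym (factorialRatio-*-! N k)) ⟩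
  signℤ k *ℤ + (factorialRatio N k * k !)                ≡⟨ cong (signℤ k *ℤ_) (ℤ.pos-* (factorialRatio N k) (k !)) ⟩
  signℤ k *ℤ (+ factorialRatio N k *ℤ + (k !))           ≡⟨ sym (ℤ.*-assoc (signℤ k) _ _) ⟩
  coeffℤ N k *ℤ + (k !)                             ∎)
  where
  open ≡-Reasoning
  N = 2 * g ∸ 3

Pℤ : (g m : ℕ) → Vec ℕ m → ℤ
Pℤ g m a = sumOf (List.upTo m) (λ K → coeffℤ (2 * g ∸ 3) (suc K) *ℤ partitionSum a (suc K) (g ∸ 2 + m))

P≡ιPℤ : ∀ g m (a : Vec ℕ m) → P g m a ≡ ι (Pℤ g m a)
P≡ιPℤ g m a = begin
  sumℚ (map (λ k → coeff g k ℚ.* ι (innerSum g k m a)) (applyUpTo suc m))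
    ≡⟨ cong sumℚ (List.map-cong term≡ (applyUpTo suc m)) ⟩
  sumℚ (map (ι ∘ F) (applyUpTo suc m))
    ≡⟨ sumℚ-ι (applyUpTo suc m) F ⟩
  ι (sumOf (applyUpTo suc m) F)
    ≡⟨ cong ι (trans (cong (λ xs → sumOf xs F) (sym (List.map-upTo suc m))) (sumOf-map (List.upTo m) suc F)) ⟩
  ι (Pℤ g m a)  ∎
  where
  open ≡-Reasoning
  F : ℕ → ℤ
  F k = coeffℤ (2 * g ∸ 3) k *ℤ partitionSum a k (g ∸ 2 + m)
  term≡ : ∀ k → coeff g k ℚ.* ι (innerSum g k m a) ≡ ι (F k)
  term≡ k = begin
    coeff g k ℚ.* ι (innerSum g k m a)
      ≡⟨ cong₂ ℚ._*_ (coeff≡ι-coeffℤ g k) (cong ι (innerSum≡partitionSum g k m a)) ⟩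
    ι (coeffℤ (2 * g ∸ 3) k) ℚ.* ι (partitionSum a k (g ∸ 2 + m))
      ≡⟨ ι-* (coeffℤ (2 * g ∸ 3) k) (partitionSum a k (g ∸ 2 + m)) ⟩
    ι (F k)  ∎

-- With N = 2g − 3 and a_[n] = N + n, the terms in partitionSum a (K + 1) (E + 1) cancel
-- and those in partitionSum a (K + 1) E carry the factor 2n − 2.
telescoping-coefficient : ∀ {k n N E E′ σ M c} (g′ n′ K x A B : ℤ) →
  k ≡ + 1 +ℤ K → n ≡ + 1 +ℤ n′ → N ≡ + 2 *ℤ g′ +ℤ + 1 → E ≡ g′ +ℤ n → E′ ≡ + 1 +ℤ E →
  σ ≡ N +ℤ n → M ≡ N +ℤ (+ 1 +ℤ k) → c ≡ + 2 *ℤ n′ →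
  x *ℤ ((k -ℤ + 2 *ℤ n +ℤ + 2 *ℤ E′) *ℤ A +ℤ (+ 4 *ℤ σ +ℤ + 3 *ℤ k +ℤ - + 2 *ℤ E) *ℤ B)
    +ℤ (- M *ℤ x) *ℤ (A +ℤ + 3 *ℤ B)
  ≡ c *ℤ (x *ℤ B)
telescoping-coefficient g′ n′ K x A B refl refl refl refl refl refl refl refl = identity g′ n′ K x A B
  where
  identity : ∀ g′ n′ K x A B →
    let k = + 1 +ℤ K; n = + 1 +ℤ n′; N = + 2 *ℤ g′ +ℤ + 1; E = g′ +ℤ n in
    x *ℤ ((k -ℤ + 2 *ℤ n +ℤ + 2 *ℤ (+ 1 +ℤ E)) *ℤ A +ℤ (+ 4 *ℤ (N +ℤ n) +ℤ + 3 *ℤ k +ℤ - + 2 *ℤ E) *ℤ B)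
      +ℤ (- (N +ℤ (+ 1 +ℤ k)) *ℤ x) *ℤ (A +ℤ + 3 *ℤ B)
    ≡ + 2 *ℤ n′ *ℤ (x *ℤ B)
  identity = solve-∀

2[g+2]≡3+[2g+1] : ∀ g → 2 * suc (suc g) ≡ 3 + (2 * g + 1)
2[g+2]≡3+[2g+1] = ℕ-Solver.solve-∀

Pℤ-∷ʳ : ∀ g′ n′ (a : Vec ℕ (suc n′)) → sum a ≡ 2 * suc (suc g′) ∸ 3 + suc n′ →
  Pℤ (suc (suc g′)) (suc (suc n′)) (a ∷ʳ 1) ≡ + (2 * suc n′ ∸ 2) *ℤ Pℤ (suc (suc g′)) (suc n′) a
Pℤ-∷ʳ g′ n′ a sum-a = begin
  sumOf (List.upTo (suc n)) (λ K → z (suc K) *ℤ partitionSum (a ∷ʳ 1) (suc K) (g′ + suc n))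
    ≡⟨ sumOf-cong (List.upTo (suc n)) recurrence ⟩
  sumOf (List.upTo (suc n)) (λ K → X K +ℤ Y K)
    ≡⟨ sumOf-upTo-stagger n X Y too-many-blocks (ℤ.*-zeroʳ (z 1)) ⟩
  sumOf (List.upTo n) (λ K → X K +ℤ Y (suc K))
    ≡⟨ sumOf-cong (List.upTo n) cancel ⟩
  sumOf (List.upTo n) (λ K → + (2 * n ∸ 2) *ℤ (z (suc K) *ℤ partitionSum a (suc K) E))
    ≡⟨ sumOf-*ˡ (List.upTo n) (+ (2 * n ∸ 2)) _ ⟩
  + (2 * n ∸ 2) *ℤ Pℤ (suc (suc g′)) n a  ∎
  where
  open ≡-Reasoning
  open AppendOne a
  n = suc n′
  N = 2 * suc (suc g′) ∸ 3
  E = g′ + n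
  z : ℕ → ℤ
  z = coeffℤ N
  X Y : ℕ → ℤ
  X K = z (suc K) *ℤ 𝒟[ leading (suc K) , trailing (suc K) ] (partitionSum a (suc K)) (suc E)
  Y K = z (suc K) *ℤ (+ suc K *ℤ (partitionSum a K (suc E) +ℤ + 3 *ℤ partitionSum a K E))
  recurrence : ∀ K → z (suc K) *ℤ partitionSum (a ∷ʳ 1) (suc K) (g′ + suc n) ≡ X K +ℤ Y K
  recurrence K = trans (cong (z (suc K) *ℤ_) (trans (cong (partitionSum (a ∷ʳ 1) (suc K)) (ℕ.+-suc g′ n))
                                                    (partitionSum-∷ʳ K E)))
                       (ℤ.*-distribˡ-+ (z (suc K)) _ _)
  too-many-blocks : X n ≡ + 0
  too-many-blocks = begin
    z (suc n) *ℤ 𝒟[ leading (suc n) , trailing (suc n) ] (partitionSum a (suc n)) (suc E)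
      ≡⟨ cong (z (suc n) *ℤ_) (𝒟-cong {leading (suc n)} {trailing (suc n)} (partitionSum-more-blocks a) (suc E)) ⟩
    z (suc n) *ℤ ((leading (suc n) +ℤ + 2 *ℤ + suc E) *ℤ + 0 +ℤ (trailing (suc n) +ℤ - + 2 *ℤ + E) *ℤ + 0)
      ≡⟨ cong (z (suc n) *ℤ_) (cong₂ _+ℤ_ (ℤ.*-zeroʳ (leading (suc n) +ℤ + 2 *ℤ + suc E))
                                          (ℤ.*-zeroʳ (trailing (suc n) +ℤ - + 2 *ℤ + E))) ⟩
    z (suc n) *ℤ + 0
      ≡⟨ ℤ.*-zeroʳ (z (suc n)) ⟩
    + 0  ∎
  N≡2g′+1 : N ≡ 2 * g′ + 1
  N≡2g′+1 = cong (_∸ 3) (2[g+2]≡3+[2g+1] g′)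
  2n∸2≡2n′ : 2 * n ∸ 2 ≡ 2 * n′
  2n∸2≡2n′ = trans (cong (_∸ 2) (ℕ.*-suc 2 n′)) (ℕ.m+n∸m≡n 2 (2 * n′))
  cancel : ∀ K → X K +ℤ Y (suc K) ≡ + (2 * n ∸ 2) *ℤ (z (suc K) *ℤ partitionSum a (suc K) E)
  cancel K = begin
    X K +ℤ z (suc (suc K)) *ℤ (+ suc (suc K) *ℤ W)
      ≡⟨ cong (X K +ℤ_) (trans (sym (ℤ.*-assoc (z (suc (suc K))) (+ suc (suc K)) W))
                               (cong (_*ℤ W) (coeffℤ-suc N (suc K)))) ⟩
    X K +ℤ (- + (N + suc (suc K)) *ℤ z (suc K)) *ℤ W
      ≡⟨ telescoping-coefficient (+ g′) (+ n′) (+ K) (z (suc K)) (J (suc E)) (J E)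
           (ℤ.pos-+ 1 K) (ℤ.pos-+ 1 n′) (trans (cong +_ N≡2g′+1) (+[2n+1] g′)) (ℤ.pos-+ g′ n) (ℤ.pos-+ 1 E)
           (trans (cong +_ sum-a) (ℤ.pos-+ N n)) (trans (ℤ.pos-+ N (suc (suc K))) (cong (+ N +ℤ_) (ℤ.pos-+ 1 (suc K))))
           (trans (cong +_ 2n∸2≡2n′) (ℤ.pos-* 2 n′)) ⟩
    + (2 * n ∸ 2) *ℤ (z (suc K) *ℤ J E)  ∎
    where
    J = partitionSum a (suc K)
    W = J (suc E) +ℤ + 3 *ℤ J E

P-∷ʳ : ∀ g′ n → 1 ≤ n → (a : Vec ℕ n) → sum a ≡ 2 * suc (suc g′) ∸ 3 + n →
  P (suc (suc g′)) (suc n) (a ∷ʳ 1) ≡ ((+ (2 * n ∸ 2)) / 1) *ℚ P (suc (suc g′)) n a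
P-∷ʳ g′ n@(suc n′) _ a sum-a = begin
  P g (suc n) (a ∷ʳ 1)                           ≡⟨ P≡ιPℤ g (suc n) (a ∷ʳ 1) ⟩
  ι (Pℤ g (suc n) (a ∷ʳ 1))                      ≡⟨ cong ι (Pℤ-∷ʳ g′ n′ a sum-a) ⟩
  ι (+ (2 * n ∸ 2) *ℤ Pℤ g n a)                  ≡⟨ sym (ι-* (+ (2 * n ∸ 2)) (Pℤ g n a)) ⟩
  ι (+ (2 * n ∸ 2)) *ℚ ι (Pℤ g n a)              ≡⟨ cong (ι (+ (2 * n ∸ 2)) *ℚ_) (sym (P≡ιPℤ g n a)) ⟩
  ((+ (2 * n ∸ 2)) / 1) *ℚ P g n a               ∎
  where
  open ≡-Reasoning
  g = suc (suc g′)

corollary5p6 : (g : ℕ) → 2 ≤ g →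
    ((n : ℕ) → 1 ≤ n → (a : Vec ℕ n) → sum a ≡ 2 * g ∸ 3 + n →
      P g (suc n) (a ∷ʳ 1) ≡ ((+ (2 * n ∸ 2)) / 1) *ℚ P g n a)
    × (P g 2 ((2 * g ∸ 2) ∷ 1 ∷ []) ≡ 0ℚ)
    × ((n : ℕ) → 2 ≤ n → (a : Vec ℕ n) → sum a ≡ 2 * g ∸ 3 + n →
      P g n a ≡ 0ℚ → P g (suc n) (a ∷ʳ 1) ≡ 0ℚ)
corollary5p6 g@(suc (suc g′)) (s≤s (s≤s z≤n)) = P-∷ʳ g′ , P₂-vanishes , vanishing-propagates
  where
  sum-[2g-2] : (2 * g ∸ 2) + 0 ≡ 2 * g ∸ 3 + 1
  sum-[2g-2] = subst (λ x → x ∸ 2 + 0 ≡ x ∸ 3 + 1) (sym (2[g+2]≡3+[2g+1] g′)) (trans (ℕ.+-identityʳ _) (ℕ.+-comm 1 _))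
  P₂-vanishes : P g 2 ((2 * g ∸ 2) ∷ 1 ∷ []) ≡ 0ℚ
  P₂-vanishes = trans (P-∷ʳ g′ 1 (s≤s z≤n) ((2 * g ∸ 2) ∷ []) sum-[2g-2]) (ℚ.*-zeroˡ (P g 1 ((2 * g ∸ 2) ∷ [])))
  vanishing-propagates : (n : ℕ) → 2 ≤ n → (a : Vec ℕ n) → sum a ≡ 2 * g ∸ 3 + n →
    P g n a ≡ 0ℚ → P g (suc n) (a ∷ʳ 1) ≡ 0ℚ
  vanishing-propagates n (s≤s _) a sum-a Pₙ≡0 = begin
    P g (suc n) (a ∷ʳ 1)                  ≡⟨ P-∷ʳ g′ n (s≤s z≤n) a sum-a ⟩
    ((+ (2 * n ∸ 2)) / 1) *ℚ P g n a      ≡⟨ cong (((+ (2 * n ∸ 2)) / 1) *ℚ_) Pₙ≡0 ⟩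
    ((+ (2 * n ∸ 2)) / 1) *ℚ 0ℚ           ≡⟨ ℚ.*-zeroʳ ((+ (2 * n ∸ 2)) / 1) ⟩
    0ℚ                                    ∎
    where open ≡-Reasoning
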